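{- (a) $M^*(\mathbb{D}_{2k+1})=B_{k+1}$ for $k\ge1$ and $M^*(\mathbb{D}_{2k})=B_{k+2}$ for $k\ge2$. (b) $M^*(\mathbb{Q}_{4n})=B_{n+2}$ for $n\ge2$ even and $M^*(\mathbb{Q}_{4n})=B_{n+1}$ for $n\ge 3$ odd. (c) $M^*(Q\mathbb{D}_n^-)=B_{3\cdot2^{n-4}+2}$ and $M^*(Q\mathbb{D}_n^+)=B_{5\cdot 2^{n-4}+1}$ for $n\ge4$.
   Context: For $n\ge3$, $\mathbb{D}_n=\langle a,b: a^n=b^2=e,\ bab=a^{ -1}\rangle$ is the dihedral group of order $2n$. For $n\ge2$, $\mathbb{Q}_{4n}=\langle a,b: a^{2n}=e,\ b^2=a^n,\ b^{ -1}ab=a^{ -1}\rangle$ is the dicyclic group of order $4n$. For $n\ge4$, $Q\mathbb{D}_n^{\pm}=\langle x,y: x^{2^{n-1}}=y^2=e,\ yxy=x^{2^{n-2}\pm1}\rangle$ are the quasidihedral groups of order $2^n$. A metric $d$ on a group $G$ is bi-invariant if $d(gh,g'h)=d(g,g')=d(hg,hg')$ for all $g,g',h$; its induced partition is the partition of $G$ into classes of $g\sim h\iff d(g,e)=d(h,e)$; two metrics are equivalent if they have the same induced partition; $M^*(G)$ is the number of equivalence classes of bi-invariant metrics on $G$. $B_m$ is the $m$-th Bell number.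
   Formalization: The bi-invariant metrics counted by $M^*(G)$ take values in ℚ instead of the nonnegative reals. -}

module Defs where

open import Data.Nat using (ℕ; zero; suc; _+_; _*_; _∸_; _^_)
open import Data.Nat.DivMod using (_mod_)
open import Data.Fin using (Fin; toℕ) renaming (zero to fzero)
open import Data.Bool using (Bool; true; false; not)
open import Data.Unit using (⊤; tt)
open import Data.Product using (Σ; ∃; _×_; _,_)
open import Data.Rational using (ℚ; 0ℚ) renaming (_≤_ to _≤ℚ_; _+_ to _+ℚ_)
open import Function.Bundles using (_⇔_)
open import Relation.Binary.PropositionalEquality using (_≡_)

stirling2 : ℕ → ℕ → ℕ
stirling2 zero    zero    = 1
stirling2 zero    (suc k) = 0
stirling2 (suc n) zero    = 0
stirling2 (suc n) (suc k) = suc k * stirling2 n (suc k) + stirling2 n k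

sumStirling : ℕ → ℕ → ℕ
sumStirling n zero    = stirling2 n zero
sumStirling n (suc j) = sumStirling n j + stirling2 n (suc j)

Bell : ℕ → ℕ
Bell m = sumStirling m m

-- Minimal group data: carrier, multiplication, identity
-- (only these are needed to define bi-invariant metrics)

record GroupData : Set₁ where
  field
    Carrier : Set
    _·_     : Carrier → Carrier → Carrier
    e       : Carrier

open GroupData public

_⊕_ : ∀ {m} → Fin m → Fin m → Fin m
_⊕_ {suc m} i j = (toℕ i + toℕ j) mod suc m

scale : ∀ {m} → ℕ → Fin m → Fin m
scale {suc m} r i = (r * toℕ i) mod suc m

res : ∀ {m} → ℕ → Fin (suc m)
res {m} t = t mod suc m

trivialGroup : GroupData
trivialGroup = record { Carrier = ⊤ ; _·_ = λ _ _ → tt ; e = tt }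

-- C_m ⋊_r C_2 = ⟨x, y : x^m = y^2 = e, y x y = x^r⟩ (r² ≡ 1 mod m).
-- Element (i , j) stands for x^i y^j  (j = true meaning y¹).
-- (x^i y^j)(x^k y^l) = x^(i + r^j k) y^(j + l).
-- For m = 0 a junk value (never used).
Twisted : ℕ → ℕ → GroupData
Twisted zero    r = trivialGroup
Twisted (suc m) r = record
  { Carrier = Fin (suc m) × Bool
  ; _·_     = mul
  ; e       = (fzero , false)
  }
  where
  mul : Fin (suc m) × Bool → Fin (suc m) × Bool → Fin (suc m) × Bool
  mul (i , false) (k , l) = (i ⊕ k , l)
  mul (i , true)  (k , l) = (i ⊕ scale r k , not l)

Dihedral : ℕ → GroupData
Dihedral n = Twisted n (n ∸ 1)

QDminus : ℕ → GroupData
QDminus n = Twisted (2 ^ (n ∸ 1)) (2 ^ (n ∸ 2) ∸ 1)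

QDplus : ℕ → GroupData
QDplus n = Twisted (2 ^ (n ∸ 1)) (2 ^ (n ∸ 2) + 1)

-- Dicyclic group ℚ_{4n} = ⟨a, b : a^{2n} = e, b^2 = a^n, b^{-1} a b = a^{-1}⟩
-- Element (i , j) stands for a^i b^j; b a^k = a^{-k} b, b b = a^n.
DicyclicAux : ℕ → ℕ → GroupData
DicyclicAux zero    n = trivialGroup
DicyclicAux (suc m) n = record
  { Carrier = Fin (suc m) × Bool
  ; _·_     = mul
  ; e       = (fzero , false)
  }
  where
  mul : Fin (suc m) × Bool → Fin (suc m) × Bool → Fin (suc m) × Bool
  mul (i , false) (k , l)     = (i ⊕ k , l)
  mul (i , true)  (k , false) = (i ⊕ scale m k , true)
  mul (i , true)  (k , true)  = ((i ⊕ scale m k) ⊕ res n , false)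

Dicyclic : ℕ → GroupData
Dicyclic n = DicyclicAux (2 * n) n

record IsBiInvMetric (G : GroupData) (d : Carrier G → Carrier G → ℚ) : Set where
  private
    _∙_ = _·_ G
  field
    nonneg     : ∀ g h → 0ℚ ≤ℚ d g h
    zero⇔eq    : ∀ g h → (d g h ≡ 0ℚ) ⇔ (g ≡ h)
    symmetric  : ∀ g h → d g h ≡ d h g
    triangle   : ∀ g h k → d g k ≤ℚ (d g h +ℚ d h k)
    right-inv  : ∀ g g′ h → d (g ∙ h) (g′ ∙ h) ≡ d g g′
    left-inv   : ∀ g g′ h → d (h ∙ g) (h ∙ g′) ≡ d g g′

BiInvMetric : GroupData → Set
BiInvMetric G = Σ (Carrier G → Carrier G → ℚ) (IsBiInvMetric G)

Equivalent : (G : GroupData) → BiInvMetric G → BiInvMetric G → Set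
Equivalent G (d , _) (d′ , _) =
  ∀ g h → (d g (e G) ≡ d h (e G)) ⇔ (d′ g (e G) ≡ d′ h (e G))

HasClassCount : (A : Set) → (A → A → Set) → ℕ → Set
HasClassCount A R k =
  Σ (Fin k → A) λ f →
    (∀ i j → R (f i) (f j) → i ≡ j) × (∀ a → ∃ λ i → R a (f i))

MStar≡ : GroupData → ℕ → Set
MStar≡ G k = HasClassCount (BiInvMetric G) (Equivalent G) k

module Submission where

-- A bi-invariant metric d is determined by its length function N g = d g e: N vanishes
-- exactly at e, is subadditive, and is invariant under conjugation and inversion, hence
-- constant on the classes of the equivalence relation generated by these two operations.
-- Two metrics are equivalent iff their length functions induce the same partition of the
-- nontrivial classes, and every partition arises, because a class function with values in
-- [1, 2] away from e is automatically subadditive. So M*(G) = B_m for m nontrivial classes.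
--
-- All groups of the statement are ⟨x, y | x^M, y² = x^c, y x y⁻¹ = x^r⟩ with r² ≡ 1 and
-- r c ≡ c (mod M). The class of x^a is the orbit of a under a ↦ r a and a ↦ -a, the class
-- of x^a y that of a under a ↦ a + (1 - r) p, a ↦ r a and a ↦ -(r a + c). For r = -1 the
-- classes of rotations are the pairs {a, -a}, and the reflections form one class (M odd),
-- two parity classes (M and c even) or one class (M even, c odd). In the quasidihedral case
-- M = 2h and r = h ∓ 1: even exponents still pair as {a, -a}, odd ones form the classes
-- {±a, ±a + h}, and the reflection classes are the parity classes (r = h - 1) or the
-- classes of ±a modulo h (r = h + 1). Counting these classes gives the Bell indices.

open import Defs
open import Algebra.Bundles using (Group)
open import Algebra.Structures using (IsGroup)
import Algebra.Properties.Group as GroupProperties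
open import Data.Bool using (Bool; true; false)
import Data.Bool.Properties as Bool
open import Data.Empty using (⊥; ⊥-elim)
open import Data.Fin using (Fin; zero; suc; toℕ; fromℕ<; splitAt; join; remQuot; combine)
open import Data.Fin.Properties using (toℕ-injective; toℕ-fromℕ<; toℕ<n; splitAt-join; join-splitAt; remQuot-combine; combine-remQuot; any?)
import Data.Fin.Properties as Fin
open import Data.Integer as ℤ using (+≤+)
open import Data.Nat using (ℕ; zero; suc; _+_; _*_; _∸_; _^_; _⊓_; _%_; _/_; _≤_; _<_; z≤n; s≤s)
open import Data.Nat.Coprimality using (coprime-+; 1-coprimeTo)
open import Data.Nat.DivMod
  using (m%n%n≡m%n; %-distribˡ-+; %-distribˡ-*; [m+kn]%n≡m%n; [m+n]%n≡m%n; m<n⇒m%n≡m; m%n<n; m∣n⇒o%n%m≡o%m; m≡m%n+[m/n]*n; m*n%n≡0)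
open import Data.Nat.Divisibility using (_∣_; divides; m%n≡0⇒n∣m)
open import Data.Nat.Properties
open import Data.Nat.Solver using (module +-*-Solver)
open import Data.Product using (Σ; ∃; _×_; _,_; proj₁; proj₂; uncurry)
open import Data.Product.Properties using (≡-dec)
open import Data.Rational as ℚ using (ℚ; mkℚ; 0ℚ; 1ℚ; *≤*)
import Data.Rational.Properties as ℚᵖ
open import Data.Sum using (_⊎_; inj₁; inj₂; [_,_]′; map₁)
open import Data.Sum.Properties using (inj₁-injective; inj₂-injective)
open import Data.Unit using (tt)
open import Data.Vec.Functional using (_∷_)
open import Function using (_∘_)
open import Function.Bundles using (_⇔_; mk⇔; Equivalence)
open import Function.Definitions using (Injective)
import Function.Properties.Equivalence as ⇔
open import Relation.Binary.Bundles using (Setoid)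
open import Relation.Binary.Definitions using (DecidableEquality)
open import Relation.Binary.Structures using (IsEquivalence)
import Relation.Binary.Reasoning.Setoid as SetoidReasoning
open import Relation.Binary.PropositionalEquality
  using (_≡_; _≢_; refl; sym; trans; cong; cong₂; subst; subst₂; isEquivalence; module ≡-Reasoning)
open import Relation.Nullary using (¬_; yes; no; toSum)

open Equivalence using (to; from)
open +-*-Solver using (solve; _:+_; _:*_; con; _:=_)

-- Set partitions and Bell numbers

SameKernel : ∀ {X A B : Set} → (X → A) → (X → B) → Set
SameKernel f g = ∀ i j → (f i ≡ f j) ⇔ (g i ≡ g j)

sameKernel-refl : ∀ {X A : Set} {f : X → A} → SameKernel f f
sameKernel-refl i j = ⇔.refl

sameKernel-sym : ∀ {X A B : Set} {f : X → A} {g : X → B} → SameKernel f g → SameKernel g f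
sameKernel-sym f~g i j = ⇔.sym (f~g i j)

sameKernel-trans : ∀ {X A B C : Set} {f : X → A} {g : X → B} {h : X → C} →
                   SameKernel f g → SameKernel g h → SameKernel f h
sameKernel-trans f~g g~h i j = ⇔.trans (f~g i j) (g~h i j)

injective⇒sameKernel-∘ : ∀ {X A B : Set} {f : X → A} {ι : A → B} → Injective _≡_ _≡_ ι → SameKernel f (ι ∘ f)
injective⇒sameKernel-∘ {ι = ι} ι-inj i j = mk⇔ (cong ι) ι-inj

sameKernel-isEquivalence : ∀ {X A : Set} → IsEquivalence (SameKernel {X} {A} {A})
sameKernel-isEquivalence = record { refl = sameKernel-refl ; sym = sameKernel-sym ; trans = sameKernel-trans }

sameKernel-∘ : ∀ {X Y A B : Set} {f : X → A} {g : X → B} (σ : Y → X) →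
               SameKernel f g → SameKernel (f ∘ σ) (g ∘ σ)
sameKernel-∘ σ f~g i j = f~g (σ i) (σ j)

sameKernel-≗ : ∀ {X A B : Set} {f : X → A} {g h : X → B} →
               SameKernel f g → (∀ i → g i ≡ h i) → SameKernel f h
sameKernel-≗ f~g g≗h i j = mk⇔
  (λ p → trans (sym (g≗h i)) (trans (to (f~g i j) p) (g≗h j)))
  (λ p → from (f~g i j) (trans (g≗h i) (trans p (sym (g≗h j)))))

private
  ≡-flip : ∀ {A B : Set} {a b : A} {c d : B} → (a ≡ b) ⇔ (c ≡ d) → (b ≡ a) ⇔ (d ≡ c)
  ≡-flip a≡b⇔c≡d = mk⇔ (λ p → sym (to a≡b⇔c≡d (sym p))) (λ p → sym (from a≡b⇔c≡d (sym p)))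

  refl⇔refl : ∀ {A B : Set} {a : A} {b : B} → (a ≡ a) ⇔ (b ≡ b)
  refl⇔refl = mk⇔ (λ _ → refl) (λ _ → refl)

sameKernel-∷ : ∀ {n} {A B : Set} {f : Fin n → A} {g : Fin n → B} {a b} →
               (∀ i → f i ≢ a) → (∀ i → g i ≢ b) → SameKernel f g → SameKernel (a ∷ f) (b ∷ g)
sameKernel-∷ f≢a g≢b same zero    zero    = refl⇔refl
sameKernel-∷ f≢a g≢b same zero    (suc j) = mk⇔ (⊥-elim ∘ f≢a j ∘ sym) (⊥-elim ∘ g≢b j ∘ sym)
sameKernel-∷ f≢a g≢b same (suc i) zero    = mk⇔ (⊥-elim ∘ f≢a i) (⊥-elim ∘ g≢b i)
sameKernel-∷ f≢a g≢b same (suc i) (suc j) = same i j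

sameKernel-∷-old : ∀ {n} {A : Set} {f : Fin (suc n) → A} {g : Fin n → ℕ} {l : ℕ} (a : Fin n) →
                   SameKernel (f ∘ suc) g → f zero ≡ f (suc a) → l ≡ g a → SameKernel f (l ∷ g)
sameKernel-∷-old a f~g fa la zero zero = refl⇔refl
sameKernel-∷-old a f~g fa la zero (suc b) =
  mk⇔ (λ p → trans la (to (f~g a b) (trans (sym fa) p))) (λ p → trans fa (from (f~g a b) (trans (sym la) p)))
sameKernel-∷-old {f = f} a f~g fa la (suc b) zero = ≡-flip (sameKernel-∷-old {f = f} a f~g fa la zero (suc b))
sameKernel-∷-old a f~g fa la (suc b) (suc c) = f~g b c

sameKernel-∷-new : ∀ {n} {A : Set} {f : Fin (suc n) → A} {g : Fin n → ℕ} {l : ℕ} →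
                   SameKernel (f ∘ suc) g → (∀ b → f zero ≢ f (suc b)) → (∀ b → g b < l) →
                   SameKernel f (l ∷ g)
sameKernel-∷-new f~g new g<l zero zero = refl⇔refl
sameKernel-∷-new f~g new g<l zero (suc b) = mk⇔ (⊥-elim ∘ new b) (λ p → ⊥-elim (<-irrefl (sym p) (g<l b)))
sameKernel-∷-new {f = f} f~g new g<l (suc b) zero = ≡-flip (sameKernel-∷-new {f = f} f~g new g<l zero (suc b))
sameKernel-∷-new f~g new g<l (suc b) (suc c) = f~g b c

splitAt-injective : ∀ m {n} {i i′ : Fin (m + n)} → splitAt m i ≡ splitAt m i′ → i ≡ i′
splitAt-injective m {n} {i} {i′} eq = begin
  i                      ≡⟨ join-splitAt m n i ⟨
  join m n (splitAt m i)  ≡⟨ cong (join m n) eq ⟩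
  join m n (splitAt m i′) ≡⟨ join-splitAt m n i′ ⟩
  i′                     ∎
  where open ≡-Reasoning

-- S(n+1, k+1) = (k+1) S(n, k+1) + S(n, k): the point 0 either joins one of the k+1 blocks of
-- a partition of the other points, or forms a block of its own.
StirlingStep : ℕ → ℕ → Set
StirlingStep n k = (Fin (suc k) × Fin (stirling2 n (suc k))) ⊎ Fin (stirling2 n k)

module _ (n k : ℕ) where

  open ≡-Reasoning

  private
    S₁ = suc k * stirling2 n (suc k)
    S₀ = stirling2 n k

    split₁ : Fin S₁ → Fin (suc k) × Fin (stirling2 n (suc k))
    split₁ = remQuot (stirling2 n (suc k))

    join₁ : Fin (suc k) × Fin (stirling2 n (suc k)) → Fin S₁
    join₁ = uncurry combine

  stirlingSplit : Fin (stirling2 (suc n) (suc k)) → StirlingStep n k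
  stirlingSplit x = map₁ split₁ (splitAt S₁ x)

  stirlingJoin : StirlingStep n k → Fin (stirling2 (suc n) (suc k))
  stirlingJoin u = join S₁ S₀ (map₁ join₁ u)

  stirlingSplit-join : ∀ u → stirlingSplit (stirlingJoin u) ≡ u
  stirlingSplit-join (inj₁ (j , y)) = begin
    map₁ split₁ (splitAt S₁ (join S₁ S₀ (inj₁ (combine j y)))) ≡⟨ cong (map₁ split₁) (splitAt-join S₁ S₀ (inj₁ (combine j y))) ⟩
    inj₁ (split₁ (combine j y))                                ≡⟨ cong inj₁ (remQuot-combine j y) ⟩
    inj₁ (j , y)                                               ∎
  stirlingSplit-join (inj₂ z) = cong (map₁ split₁) (splitAt-join S₁ S₀ (inj₂ z))

  stirlingJoin-split : ∀ x → stirlingJoin (stirlingSplit x) ≡ x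
  stirlingJoin-split x with splitAt S₁ x in eq
  ... | inj₁ y = begin
    join S₁ S₀ (inj₁ (join₁ (split₁ y))) ≡⟨ cong (join S₁ S₀ ∘ inj₁) (combine-remQuot {suc k} (stirling2 n (suc k)) y) ⟩
    join S₁ S₀ (inj₁ y)                  ≡⟨ cong (join S₁ S₀) eq ⟨
    join S₁ S₀ (splitAt S₁ x)            ≡⟨ join-splitAt S₁ S₀ x ⟩
    x                                    ∎
  ... | inj₂ z = trans (cong (join S₁ S₀) (sym eq)) (join-splitAt S₁ S₀ x)

  stirlingSplit-injective : ∀ {x x′} → stirlingSplit x ≡ stirlingSplit x′ → x ≡ x′
  stirlingSplit-injective {x} {x′} eq = begin
    x                               ≡⟨ stirlingJoin-split x ⟨
    stirlingJoin (stirlingSplit x)  ≡⟨ cong stirlingJoin eq ⟩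
    stirlingJoin (stirlingSplit x′) ≡⟨ stirlingJoin-split x′ ⟩
    x′                              ∎

labelling : ∀ n k → Fin (stirling2 n k) → Fin n → ℕ
labellingStep : ∀ n k → StirlingStep n k → Fin (suc n) → ℕ

labelling zero    zero    _ ()
labelling zero    (suc k) ()
labelling (suc n) zero    ()
labelling (suc n) (suc k) x = labellingStep n k (stirlingSplit n k x)

labellingStep n k (inj₁ (j , y)) = toℕ j ∷ labelling n (suc k) y
labellingStep n k (inj₂ z)       = k ∷ labelling n k z

labelling-< : ∀ n k x i → labelling n k x i < k
labelling-< zero    zero    _ ()
labelling-< zero    (suc k) ()
labelling-< (suc n) zero    ()
labelling-< (suc n) (suc k) x i with stirlingSplit n k x
labelling-< (suc n) (suc k) x zero    | inj₁ (j , y) = toℕ<n j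
labelling-< (suc n) (suc k) x (suc i) | inj₁ (j , y) = labelling-< n (suc k) y i
labelling-< (suc n) (suc k) x zero    | inj₂ z       = ≤-refl
labelling-< (suc n) (suc k) x (suc i) | inj₂ z       = m≤n⇒m≤1+n (labelling-< n k z i)

labelling-onto : ∀ n k x l → l < k → ∃ λ i → labelling n k x i ≡ l
labelling-onto zero    zero    _ l ()
labelling-onto zero    (suc k) ()
labelling-onto (suc n) zero    ()
labelling-onto (suc n) (suc k) x l l<k with stirlingSplit n k x
... | inj₁ (j , y) = let (i , eq) = labelling-onto n (suc k) y l l<k in suc i , eq
... | inj₂ z with l ≟ k
...   | yes refl = zero , refl
...   | no l≢k = let (i , eq) = labelling-onto n k z l (≤∧≢⇒< (≤-pred l<k) l≢k) in suc i , eq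

private
  -- in the left summand label 0 is shared with another point, in the right one it is not
  step-mixed : ∀ n k k′ j y z → SameKernel (labellingStep n k (inj₁ (j , y))) (labellingStep n k′ (inj₂ z)) → ⊥
  step-mixed n k k′ j y z same =
    let (i , yi≡j) = labelling-onto n (suc k) y (toℕ j) (toℕ<n j)
    in <-irrefl (sym (to (same zero (suc i)) (sym yi≡j))) (labelling-< n k′ z i)

Partition : ℕ → Set
Partition n = Σ ℕ λ k → Fin (stirling2 n k)

labelling-injective : ∀ n {k k′} x x′ → SameKernel (labelling n k x) (labelling n k′ x′) →
                      _≡_ {A = Partition n} (k , x) (k′ , x′)
labelling-injective zero {zero} {zero} zero zero _ = refl
labelling-injective zero {zero} {suc k′} _ ()
labelling-injective zero {suc k} ()
labelling-injective (suc n) {zero} ()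
labelling-injective (suc n) {suc k} {zero} _ ()
labelling-injective (suc n) {suc k} {suc k′} x x′ same
  with stirlingSplit n k x in eq | stirlingSplit n k′ x′ in eq′
... | inj₁ (j , y) | inj₂ z′       = ⊥-elim (step-mixed n k k′ j y z′ same)
... | inj₂ z       | inj₁ (j′ , y′) = ⊥-elim (step-mixed n k′ k j′ y′ z (sameKernel-sym same))
... | inj₂ z       | inj₂ z′
  with refl ← labelling-injective n z z′ (sameKernel-∘ suc same)
  = cong (suc k ,_) (stirlingSplit-injective n k (trans eq (sym eq′)))
... | inj₁ (j , y) | inj₁ (j′ , y′)
  with refl ← labelling-injective n y y′ (sameKernel-∘ suc same)
  = cong (suc k ,_) (stirlingSplit-injective n k (trans eq (trans (cong (λ j → inj₁ (j , y)) j≡j′) (sym eq′))))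
  where
  j≡j′ : j ≡ j′
  j≡j′ = let (i , yi≡j) = labelling-onto n (suc k) y (toℕ j) (toℕ<n j)
         in toℕ-injective (trans (sym yi≡j) (sym (to (same zero (suc i)) (sym yi≡j))))

labelling-join : ∀ n k u i → labelling (suc n) (suc k) (stirlingJoin n k u) i ≡ labellingStep n k u i
labelling-join n k u i = cong (λ v → labellingStep n k v i) (stirlingSplit-join n k u)

labelling-complete : ∀ {A : Set} → DecidableEquality A → ∀ n (f : Fin n → A) →
                     Σ ℕ λ k → k ≤ n × Σ (Fin (stirling2 n k)) λ x → SameKernel f (labelling n k x)
labelling-complete _≟_ zero f = 0 , z≤n , zero , λ ()
labelling-complete _≟_ (suc n) f
  with labelling-complete _≟_ n (f ∘ suc) | any? (λ a → f zero ≟ f (suc a))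
... | zero , _ , x , _ | yes (a , _) = ⊥-elim (n≮0 (labelling-< n zero x a))
... | suc k , k≤n , x , same | yes (a , f0≡fa) =
  suc k , m≤n⇒m≤1+n k≤n , stirlingJoin n k (inj₁ (j , x)) ,
  sameKernel-≗ (sameKernel-∷-old {f = f} a same f0≡fa (toℕ-fromℕ< _)) (λ i → sym (labelling-join n k (inj₁ (j , x)) i))
  where
  j : Fin (suc k)
  j = fromℕ< (labelling-< n (suc k) x a)
... | k , k≤n , x , same | no fresh =
  suc k , s≤s k≤n , stirlingJoin n k (inj₂ x) ,
  sameKernel-≗ (sameKernel-∷-new {f = f} same (λ b p → fresh (b , p)) (labelling-< n k x))
               (λ i → sym (labelling-join n k (inj₂ x) i))

bellCode : ∀ n j → Fin (sumStirling n j) → Partition n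
bellCode n zero    x = 0 , x
bellCode n (suc j) x = [ bellCode n j , (suc j ,_) ]′ (splitAt (sumStirling n j) x)

bellCode-≤ : ∀ n j x → proj₁ (bellCode n j x) ≤ j
bellCode-≤ n zero    x = z≤n
bellCode-≤ n (suc j) x with splitAt (sumStirling n j) x
... | inj₁ y = m≤n⇒m≤1+n (bellCode-≤ n j y)
... | inj₂ z = ≤-refl

bellCode-injective : ∀ n j {x x′} → bellCode n j x ≡ bellCode n j x′ → x ≡ x′
bellCode-injective n zero refl = refl
bellCode-injective n (suc j) {x} {x′} eq
  with splitAt (sumStirling n j) x in ex | splitAt (sumStirling n j) x′ in ex′
... | inj₁ y | inj₁ y′ = splitAt-injective _ (trans ex (trans (cong inj₁ (bellCode-injective n j eq)) (sym ex′)))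
... | inj₁ y | inj₂ _  = ⊥-elim (<-irrefl refl (subst (_≤ j) (cong proj₁ eq) (bellCode-≤ n j y)))
... | inj₂ _ | inj₁ y′ = ⊥-elim (<-irrefl refl (subst (_≤ j) (cong proj₁ (sym eq)) (bellCode-≤ n j y′)))
... | inj₂ z | inj₂ z′ with refl ← eq = splitAt-injective _ (trans ex (sym ex′))

bellCode-onto : ∀ n j k → k ≤ j → (y : Fin (stirling2 n k)) → ∃ λ x → bellCode n j x ≡ (k , y)
bellCode-onto n zero    zero z≤n y = y , refl
bellCode-onto n (suc j) k k≤j y with k ≟ suc j
... | yes refl = join _ _ (inj₂ y) , cong [ bellCode n j , (suc j ,_) ]′ (splitAt-join _ _ (inj₂ y))
... | no k≢1+j =
  let (x , eq) = bellCode-onto n j k (≤-pred (≤∧≢⇒< k≤j k≢1+j)) y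
  in join _ _ (inj₁ x) , trans (cong [ bellCode n j , (suc j ,_) ]′ (splitAt-join _ _ (inj₁ x))) eq

bellLabelling : ∀ n → Fin (Bell n) → Fin n → ℕ
bellLabelling n x = uncurry (labelling n) (bellCode n n x)

bellLabelling-injective : ∀ n {x x′} → SameKernel (bellLabelling n x) (bellLabelling n x′) → x ≡ x′
bellLabelling-injective n same = bellCode-injective n n (labelling-injective n _ _ same)

bellLabelling-complete : ∀ {A : Set} → DecidableEquality A → ∀ n (f : Fin n → A) →
                         ∃ λ x → SameKernel f (bellLabelling n x)
bellLabelling-complete _≟_ n f =
  let (k , k≤n , y , same) = labelling-complete _≟_ n f
      (x , eq) = bellCode-onto n n k k≤n y
  in x , sameKernel-≗ same (λ i → cong (λ p → uncurry (labelling n) p i) (sym eq))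

labellings-classCount : ∀ {A : Set} → DecidableEquality A → (ι : ℕ → A) → Injective _≡_ _≡_ ι →
                        ∀ n → HasClassCount (Fin n → A) SameKernel (Bell n)
labellings-classCount _≟_ ι ι-inj n = rep , rep-injective , cover
  where
  rep : Fin (Bell n) → Fin n → _
  rep x = ι ∘ bellLabelling n x

  rep-injective : ∀ x x′ → SameKernel (rep x) (rep x′) → x ≡ x′
  rep-injective x x′ same = bellLabelling-injective n
    (sameKernel-trans (injective⇒sameKernel-∘ ι-inj) (sameKernel-trans same (sameKernel-sym (injective⇒sameKernel-∘ ι-inj))))

  cover : ∀ f → ∃ λ x → SameKernel f (rep x)
  cover f = let (x , same) = bellLabelling-complete _≟_ n f in x , sameKernel-trans same (injective⇒sameKernel-∘ ι-inj)

classCount-transfer : ∀ {X Y : Set} {R : X → X → Set} {S : Y → Y → Set} {k} → IsEquivalence S →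
                      (F : X → Y) → (∀ x x′ → R x x′ ⇔ S (F x) (F x′)) → (∀ y → ∃ λ x → S y (F x)) →
                      HasClassCount Y S k → HasClassCount X R k
classCount-transfer {X} {R = R} {S} S-equiv F reflects full (rep , rep-injective , cover) =
  rep′ , rep′-injective , cover′
  where
  open IsEquivalence S-equiv renaming (sym to S-sym; trans to S-trans)

  rep′ : _ → X
  rep′ i = proj₁ (full (rep i))

  rep~rep′ : ∀ i → S (rep i) (F (rep′ i))
  rep~rep′ i = proj₂ (full (rep i))

  rep′-injective : ∀ i j → R (rep′ i) (rep′ j) → i ≡ j
  rep′-injective i j r = rep-injective i j (S-trans (rep~rep′ i) (S-trans (to (reflects _ _) r) (S-sym (rep~rep′ j))))

  cover′ : ∀ x → ∃ λ i → R x (rep′ i)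
  cover′ x = let (i , s) = cover (F x) in i , from (reflects _ _) (S-trans s (rep~rep′ i))

-- Bi-invariant metrics and conjugacy-inversion classes

2ℚ : ℚ
2ℚ = 1ℚ ℚ.+ 1ℚ

-- (l + 2) / (l + 1); mkℚ takes the denominator minus one
weight : ℕ → ℚ
weight l = mkℚ (ℤ.+ (suc l + 1)) l (coprime-+ (1-coprimeTo (suc l)))

weight-injective : ∀ {a b} → weight a ≡ weight b → a ≡ b
weight-injective = cong ℚ.denominator-1

1≤weight : ∀ l → 1ℚ ℚ.≤ weight l
1≤weight l = *≤* (+≤+ (s≤s (subst₂ _≤_ (sym (+-identityʳ l)) (sym (*-identityʳ (l + 1))) (m≤m+n l 1))))

weight≤2 : ∀ l → weight l ℚ.≤ 2ℚ
weight≤2 l = *≤* (+≤+ (s≤s (subst₂ _≤_ (sym (*-identityʳ (l + 1))) (cong (l +_) (sym (*-identityˡ (suc l))))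
                                    (+-monoʳ-≤ l (s≤s z≤n)))))

1≰0 : ¬ (1ℚ ℚ.≤ 0ℚ)
1≰0 (*≤* (+≤+ ()))

module BiInvariantMetrics (G : GroupData) (_⁻¹ : Carrier G → Carrier G)
                          (isGroup : IsGroup _≡_ (_·_ G) (e G) _⁻¹)
                          (_≟_ : DecidableEquality (Carrier G)) where

  private
    group : Group _ _
    group = record { isGroup = isGroup }

  open Group group using (_∙_; ε; assoc; identityˡ; identityʳ; inverseˡ; inverseʳ)
  open GroupProperties group using (ε⁻¹≈ε; ⁻¹-anti-homo-∙; ⁻¹-anti-homo-//; x∙y⁻¹≈ε⇒x≈y; inverseʳ-unique)
  open ≡-Reasoning

  data _∼_ : Carrier G → Carrier G → Set where
    ∼-refl  : ∀ {a} → a ∼ a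
    ∼-sym   : ∀ {a b} → a ∼ b → b ∼ a
    ∼-trans : ∀ {a b c} → a ∼ b → b ∼ c → a ∼ c
    ∼-conj  : ∀ h a → a ∼ (h ∙ a ∙ h ⁻¹)
    ∼-inv   : ∀ a → a ∼ (a ⁻¹)

  ∼-invariant : ∀ {B : Set} (f : Carrier G → B) → (∀ h a → f (h ∙ a ∙ h ⁻¹) ≡ f a) → (∀ a → f (a ⁻¹) ≡ f a) →
                ∀ {a b} → a ∼ b → f a ≡ f b
  ∼-invariant f f-conj f-inv ∼-refl          = refl
  ∼-invariant f f-conj f-inv (∼-sym a∼b)     = sym (∼-invariant f f-conj f-inv a∼b)
  ∼-invariant f f-conj f-inv (∼-trans a∼b b∼c) = trans (∼-invariant f f-conj f-inv a∼b) (∼-invariant f f-conj f-inv b∼c)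
  ∼-invariant f f-conj f-inv (∼-conj h a)    = sym (f-conj h a)
  ∼-invariant f f-conj f-inv (∼-inv a)       = sym (f-inv a)

  conj-≡ε : ∀ h a → h ∙ a ∙ h ⁻¹ ≡ ε → a ≡ ε
  conj-≡ε h a hah⁻¹≡ε = begin
    a                    ≡⟨ identityʳ a ⟨
    a ∙ ε                ≡⟨ cong (a ∙_) (inverseˡ h) ⟨
    a ∙ (h ⁻¹ ∙ h)       ≡⟨ assoc a (h ⁻¹) h ⟨
    a ∙ h ⁻¹ ∙ h         ≡⟨ cong (_∙ h) (inverseʳ-unique h (a ∙ h ⁻¹) (trans (sym (assoc h a (h ⁻¹))) hah⁻¹≡ε)) ⟩
    h ⁻¹ ∙ h             ≡⟨ inverseˡ h ⟩
    ε                    ∎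

  ε-conj : ∀ h → h ∙ ε ∙ h ⁻¹ ≡ ε
  ε-conj h = trans (cong (_∙ h ⁻¹) (identityʳ h)) (inverseʳ h)

  ⁻¹-≡ε : ∀ a → a ⁻¹ ≡ ε → a ≡ ε
  ⁻¹-≡ε a a⁻¹≡ε = trans (sym (identityʳ a)) (trans (cong (a ∙_) (sym a⁻¹≡ε)) (inverseʳ a))

  ∼-≡ε : ∀ {a b} → a ∼ b → (a ≡ ε) ⇔ (b ≡ ε)
  ∼-≡ε ∼-refl            = mk⇔ (λ p → p) (λ p → p)
  ∼-≡ε (∼-sym a∼b)       = mk⇔ (from (∼-≡ε a∼b)) (to (∼-≡ε a∼b))
  ∼-≡ε (∼-trans a∼b b∼c) = mk⇔ (to (∼-≡ε b∼c) ∘ to (∼-≡ε a∼b)) (from (∼-≡ε a∼b) ∘ from (∼-≡ε b∼c))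
  ∼-≡ε (∼-conj h a)      = mk⇔ (λ { refl → ε-conj h }) (conj-≡ε h a)
  ∼-≡ε (∼-inv a)         = mk⇔ (λ { refl → ε⁻¹≈ε }) (⁻¹-≡ε a)

  length : BiInvMetric G → Carrier G → ℚ
  length (d , _) g = d g ε

  module _ (D : BiInvMetric G) where
    private
      d = proj₁ D
      open IsBiInvMetric (proj₂ D)

    length-conj : ∀ h a → length D (h ∙ a ∙ h ⁻¹) ≡ length D a
    length-conj h a = begin
      d (h ∙ a ∙ h ⁻¹) ε          ≡⟨ cong (d (h ∙ a ∙ h ⁻¹)) (inverseʳ h) ⟨
      d (h ∙ a ∙ h ⁻¹) (h ∙ h ⁻¹) ≡⟨ right-inv (h ∙ a) h (h ⁻¹) ⟩
      d (h ∙ a) h                 ≡⟨ cong (d (h ∙ a)) (identityʳ h) ⟨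
      d (h ∙ a) (h ∙ ε)           ≡⟨ left-inv a ε h ⟩
      d a ε                       ∎

    length-⁻¹ : ∀ a → length D (a ⁻¹) ≡ length D a
    length-⁻¹ a = begin
      d (a ⁻¹) ε       ≡⟨ symmetric (a ⁻¹) ε ⟩
      d ε (a ⁻¹)       ≡⟨ cong (λ x → d x (a ⁻¹)) (inverseʳ a) ⟨
      d (a ∙ a ⁻¹) (a ⁻¹) ≡⟨ cong (d (a ∙ a ⁻¹)) (identityˡ (a ⁻¹)) ⟨
      d (a ∙ a ⁻¹) (ε ∙ a ⁻¹) ≡⟨ right-inv a ε (a ⁻¹) ⟩
      d a ε            ∎

    length-∼ : ∀ {a b} → a ∼ b → length D a ≡ length D b
    length-∼ = ∼-invariant (length D) length-conj length-⁻¹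

  private
    insert-ε : ∀ {a b} g x → a ∙ b ≡ ε → g ∙ x ≡ g ∙ a ∙ (b ∙ x)
    insert-ε {a} {b} g x ab≡ε = begin
      g ∙ x             ≡⟨ cong (_∙ x) (identityʳ g) ⟨
      g ∙ ε ∙ x         ≡⟨ cong (λ y → g ∙ y ∙ x) ab≡ε ⟨
      g ∙ (a ∙ b) ∙ x   ≡⟨ cong (_∙ x) (assoc g a b) ⟨
      g ∙ a ∙ b ∙ x     ≡⟨ assoc (g ∙ a) b x ⟩
      g ∙ a ∙ (b ∙ x)   ∎

    //-cancelʳ : ∀ g g′ h → (g ∙ h) ∙ (g′ ∙ h) ⁻¹ ≡ g ∙ g′ ⁻¹
    //-cancelʳ g g′ h = begin
      g ∙ h ∙ (g′ ∙ h) ⁻¹       ≡⟨ cong (g ∙ h ∙_) (⁻¹-anti-homo-∙ g′ h) ⟩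
      g ∙ h ∙ (h ⁻¹ ∙ g′ ⁻¹)    ≡⟨ insert-ε g (g′ ⁻¹) (inverseʳ h) ⟨
      g ∙ g′ ⁻¹                 ∎

    //-conjˡ : ∀ g g′ h → (h ∙ g) ∙ (h ∙ g′) ⁻¹ ≡ h ∙ (g ∙ g′ ⁻¹) ∙ h ⁻¹
    //-conjˡ g g′ h = begin
      h ∙ g ∙ (h ∙ g′) ⁻¹       ≡⟨ cong (h ∙ g ∙_) (⁻¹-anti-homo-∙ h g′) ⟩
      h ∙ g ∙ (g′ ⁻¹ ∙ h ⁻¹)    ≡⟨ assoc (h ∙ g) (g′ ⁻¹) (h ⁻¹) ⟨
      h ∙ g ∙ g′ ⁻¹ ∙ h ⁻¹      ≡⟨ cong (_∙ h ⁻¹) (assoc h g (g′ ⁻¹)) ⟩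
      h ∙ (g ∙ g′ ⁻¹) ∙ h ⁻¹    ∎

  module NormMetric (N : Carrier G → ℚ) (N-ε : N ε ≡ 0ℚ)
                    (N-bounds : ∀ g → g ≢ ε → 1ℚ ℚ.≤ N g × N g ℚ.≤ 2ℚ)
                    (N-∼ : ∀ {a b} → a ∼ b → N a ≡ N b) where

    N-nonneg : ∀ g → 0ℚ ℚ.≤ N g
    N-nonneg g with g ≟ ε
    ... | yes refl = ℚᵖ.≤-reflexive (sym N-ε)
    ... | no g≢ε   = ℚᵖ.≤-trans (ℚᵖ.nonNegative⁻¹ 1ℚ) (proj₁ (N-bounds g g≢ε))

    N≤2 : ∀ g → N g ℚ.≤ 2ℚ
    N≤2 g with g ≟ ε
    ... | yes refl = ℚᵖ.≤-trans (ℚᵖ.≤-reflexive N-ε) (ℚᵖ.nonNegative⁻¹ 2ℚ)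
    ... | no g≢ε   = proj₂ (N-bounds g g≢ε)

    -- values in [1, 2] away from ε make subadditivity automatic
    N-subadditive : ∀ x y → N (x ∙ y) ℚ.≤ N x ℚ.+ N y
    N-subadditive x y with x ≟ ε | y ≟ ε
    ... | yes refl | _ = ℚᵖ.≤-reflexive (begin
      N (ε ∙ y)     ≡⟨ cong N (identityˡ y) ⟩
      N y           ≡⟨ ℚᵖ.+-identityˡ (N y) ⟨
      0ℚ ℚ.+ N y    ≡⟨ cong (ℚ._+ N y) N-ε ⟨
      N ε ℚ.+ N y   ∎)
    ... | no _ | yes refl = ℚᵖ.≤-reflexive (begin
      N (x ∙ ε)     ≡⟨ cong N (identityʳ x) ⟩
      N x           ≡⟨ ℚᵖ.+-identityʳ (N x) ⟨
      N x ℚ.+ 0ℚ    ≡⟨ cong (N x ℚ.+_) N-ε ⟨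
      N x ℚ.+ N ε   ∎)
    ... | no x≢ε | no y≢ε =
      ℚᵖ.≤-trans (N≤2 (x ∙ y)) (ℚᵖ.+-mono-≤ (proj₁ (N-bounds x x≢ε)) (proj₁ (N-bounds y y≢ε)))

    distance : Carrier G → Carrier G → ℚ
    distance g h = N (g ∙ h ⁻¹)

    isBiInvMetric : IsBiInvMetric G distance
    isBiInvMetric = record
      { nonneg    = λ g h → N-nonneg (g ∙ h ⁻¹)
      ; zero⇔eq   = λ g h → mk⇔ (zero⇒eq g h) (λ { refl → trans (cong N (inverseʳ g)) N-ε })
      ; symmetric = λ g h → trans (N-∼ (∼-inv (g ∙ h ⁻¹))) (cong N (⁻¹-anti-homo-// g h))
      ; triangle  = λ g h k → subst (λ x → N x ℚ.≤ distance g h ℚ.+ distance h k)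
                                    (sym (insert-ε g (k ⁻¹) (inverseˡ h))) (N-subadditive (g ∙ h ⁻¹) (h ∙ k ⁻¹))
      ; right-inv = λ g g′ h → cong N (//-cancelʳ g g′ h)
      ; left-inv  = λ g g′ h → trans (cong N (//-conjˡ g g′ h)) (sym (N-∼ (∼-conj h (g ∙ g′ ⁻¹))))
      }
      where
      zero⇒eq : ∀ g h → N (g ∙ h ⁻¹) ≡ 0ℚ → g ≡ h
      zero⇒eq g h N≡0 with (g ∙ h ⁻¹) ≟ ε
      ... | yes gh⁻¹≡ε = x∙y⁻¹≈ε⇒x≈y g h gh⁻¹≡ε
      ... | no gh⁻¹≢ε  = ⊥-elim (1≰0 (subst (1ℚ ℚ.≤_) N≡0 (proj₁ (N-bounds _ gh⁻¹≢ε))))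

  record OrbitTransversal (m : ℕ) : Set where
    field
      rep           : Fin m → Carrier G
      rep≢ε         : ∀ i → rep i ≢ ε
      classify      : ∀ g → g ≢ ε → ∃ λ i → g ∼ rep i
      rep-separated : ∀ i j → rep i ∼ rep j → i ≡ j

  module _ {m} (T : OrbitTransversal m) where
    open OrbitTransversal T

    lengths : BiInvMetric G → Fin m → ℚ
    lengths D i = length D (rep i)

    realize : (P : Fin m → ℚ) → (∀ i → 1ℚ ℚ.≤ P i × P i ℚ.≤ 2ℚ) →
              Σ (BiInvMetric G) λ D → ∀ i → lengths D i ≡ P i
    realize P P-bounds = (distance , isBiInvMetric) , length-rep
      where
      N : Carrier G → ℚ
      N g with g ≟ ε
      ... | yes _   = 0ℚ
      ... | no g≢ε = P (proj₁ (classify g g≢ε))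

      N-ε : N ε ≡ 0ℚ
      N-ε with ε ≟ ε
      ... | yes _  = refl
      ... | no ε≢ε = ⊥-elim (ε≢ε refl)

      N-bounds : ∀ g → g ≢ ε → 1ℚ ℚ.≤ N g × N g ℚ.≤ 2ℚ
      N-bounds g g≢ε with g ≟ ε
      ... | yes g≡ε = ⊥-elim (g≢ε g≡ε)
      ... | no _    = P-bounds _

      N-∼ : ∀ {a b} → a ∼ b → N a ≡ N b
      N-∼ {a} {b} a∼b with a ≟ ε | b ≟ ε
      ... | yes _   | yes _   = refl
      ... | yes a≡ε | no b≢ε  = ⊥-elim (b≢ε (to (∼-≡ε a∼b) a≡ε))
      ... | no a≢ε  | yes b≡ε = ⊥-elim (a≢ε (from (∼-≡ε a∼b) b≡ε))
      ... | no a≢ε  | no b≢ε  =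
        let (i , a∼i) = classify a a≢ε
            (j , b∼j) = classify b b≢ε
        in cong P (rep-separated i j (∼-trans (∼-sym a∼i) (∼-trans a∼b b∼j)))

      open NormMetric N N-ε N-bounds N-∼

      N-rep : ∀ i → N (rep i) ≡ P i
      N-rep i with rep i ≟ ε
      ... | yes i≡ε = ⊥-elim (rep≢ε i i≡ε)
      ... | no i≢ε  = cong P (sym (rep-separated i _ (proj₂ (classify (rep i) i≢ε))))

      length-rep : ∀ i → N (rep i ∙ ε ⁻¹) ≡ P i
      length-rep i = trans (cong N (trans (cong (rep i ∙_) ε⁻¹≈ε) (identityʳ (rep i)))) (N-rep i)

    private
      length-ε : ∀ D → length D ε ≡ 0ℚ
      length-ε (_ , isMetric) = from (IsBiInvMetric.zero⇔eq isMetric ε ε) refl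

      lengths≢0 : ∀ D i → lengths D i ≢ 0ℚ
      lengths≢0 (_ , isMetric) i = rep≢ε i ∘ to (IsBiInvMetric.zero⇔eq isMetric (rep i) ε)

      -- the orbit of ε is {ε}; index 0 stands for it
      orbit : Carrier G → Fin (suc m)
      orbit g with g ≟ ε
      ... | yes _   = zero
      ... | no g≢ε = suc (proj₁ (classify g g≢ε))

      length-orbit : ∀ D g → length D g ≡ (0ℚ ∷ lengths D) (orbit g)
      length-orbit D g with g ≟ ε
      ... | yes refl = length-ε D
      ... | no g≢ε   = length-∼ D (proj₂ (classify g g≢ε))

    equivalent⇔sameKernel : ∀ D D′ → Equivalent G D D′ ⇔ SameKernel (lengths D) (lengths D′)
    equivalent⇔sameKernel D D′ = mk⇔ (λ eqv i j → eqv (rep i) (rep j)) from-lengths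
      where
      from-lengths : SameKernel (lengths D) (lengths D′) → SameKernel (length D) (length D′)
      from-lengths same =
        sameKernel-sym (sameKernel-≗ (sameKernel-sym (sameKernel-≗
          (sameKernel-∘ orbit (sameKernel-∷ (lengths≢0 D) (lengths≢0 D′) same))
          (sym ∘ length-orbit D′))) (sym ∘ length-orbit D))

    transversal⇒MStar≡Bell : MStar≡ G (Bell m)
    transversal⇒MStar≡Bell =
      classCount-transfer sameKernel-isEquivalence lengths equivalent⇔sameKernel realizeKernel
                          (labellings-classCount ℚ._≟_ weight weight-injective m)
      where
      realizeKernel : ∀ f → ∃ λ D → SameKernel f (lengths D)
      realizeKernel f =
        let (x , same) = bellLabelling-complete ℚ._≟_ m f
            (D , lengths≗) = realize (weight ∘ bellLabelling m x) (λ i → 1≤weight _ , weight≤2 _)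
        in D , sameKernel-≗ (sameKernel-trans same (injective⇒sameKernel-∘ weight-injective)) (sym ∘ lengths≗)

MStar≡-cong : ∀ {C : Set} {_∙_ _∘_ : C → C → C} {ε : C} {k} → (∀ x y → x ∙ y ≡ x ∘ y) →
              MStar≡ (record { Carrier = C ; _·_ = _∙_ ; e = ε }) k →
              MStar≡ (record { Carrier = C ; _·_ = _∘_ ; e = ε }) k
MStar≡-cong {C} {_∙_} {_∘_} {ε} ∙≗∘ (rep , rep-injective , cover) =
  (λ i → retarget ∙≗∘ (rep i)) , rep-injective , λ D → cover (retarget (λ x y → sym (∙≗∘ x y)) D)
  where
  retarget : ∀ {_⊕_ _⊗_ : C → C → C} → (∀ x y → x ⊕ y ≡ x ⊗ y) →
             BiInvMetric (record { Carrier = C ; _·_ = _⊕_ ; e = ε }) →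
             BiInvMetric (record { Carrier = C ; _·_ = _⊗_ ; e = ε })
  retarget ⊕≗⊗ (d , isMetric) = d , record
    { nonneg    = nonneg
    ; zero⇔eq   = zero⇔eq
    ; symmetric = symmetric
    ; triangle  = triangle
    ; right-inv = λ g g′ h → trans (cong₂ d (sym (⊕≗⊗ g h)) (sym (⊕≗⊗ g′ h))) (right-inv g g′ h)
    ; left-inv  = λ g g′ h → trans (cong₂ d (sym (⊕≗⊗ h g)) (sym (⊕≗⊗ h g′))) (left-inv g g′ h)
    }
    where open IsBiInvMetric isMetric

-- Congruences

-- modulo M = m + 1, written as a successor so that it is nonzero
module Modular (m : ℕ) where

  M : ℕ
  M = suc m

  infix 4 _≈_
  record _≈_ (a b : ℕ) : Set where
    constructor mk≈
    field %-≡ : a % M ≡ b % M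
  open _≈_ public

  ≈-refl : ∀ {a} → a ≈ a
  ≈-refl = mk≈ refl

  ≈-sym : ∀ {a b} → a ≈ b → b ≈ a
  ≈-sym (mk≈ p) = mk≈ (sym p)

  ≈-trans : ∀ {a b c} → a ≈ b → b ≈ c → a ≈ c
  ≈-trans (mk≈ p) (mk≈ q) = mk≈ (trans p q)

  ≡⇒≈ : ∀ {a b} → a ≡ b → a ≈ b
  ≡⇒≈ refl = ≈-refl

  ≈-setoid : Setoid _ _
  ≈-setoid = record { _≈_ = _≈_ ; isEquivalence = record { refl = ≈-refl ; sym = ≈-sym ; trans = ≈-trans } }

  module ≈-Reasoning = SetoidReasoning ≈-setoid

  +-cong : ∀ {a a′ b b′} → a ≈ a′ → b ≈ b′ → a + b ≈ a′ + b′
  +-cong {a} {a′} {b} {b′} (mk≈ p) (mk≈ q) =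
    mk≈ (trans (%-distribˡ-+ a b M) (trans (cong₂ (λ x y → (x + y) % M) p q) (sym (%-distribˡ-+ a′ b′ M))))

  *-cong : ∀ {a a′ b b′} → a ≈ a′ → b ≈ b′ → a * b ≈ a′ * b′
  *-cong {a} {a′} {b} {b′} (mk≈ p) (mk≈ q) =
    mk≈ (trans (%-distribˡ-* a b M) (trans (cong₂ (λ x y → (x * y) % M) p q) (sym (%-distribˡ-* a′ b′ M))))

  +-congˡ : ∀ c {a b} → a ≈ b → c + a ≈ c + b
  +-congˡ c = +-cong (≈-refl {c})

  +-congʳ : ∀ c {a b} → a ≈ b → a + c ≈ b + c
  +-congʳ c p = +-cong p ≈-refl

  *-congˡ : ∀ c {a b} → a ≈ b → c * a ≈ c * b
  *-congˡ c = *-cong (≈-refl {c})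

  +-*M : ∀ a k → a + k * M ≈ a
  +-*M a k = mk≈ ([m+kn]%n≡m%n a k M)

  %M≈ : ∀ a → a % M ≈ a
  %M≈ a = mk≈ (m%n%n≡m%n a M)

  -- m = M - 1 acts as -1
  +-m* : ∀ a → a + m * a ≈ 0
  +-m* a = ≈-trans (≡⇒≈ (solve 2 (λ a m → a :+ m :* a := con 0 :+ a :* (con 1 :+ m)) refl a m)) (+-*M 0 a)

  +-cancelʳ : ∀ {a b} x → a + x ≈ b + x → a ≈ b
  +-cancelʳ {a} {b} x a+x≈b+x = begin
    a                   ≈⟨ +-*M a x ⟨
    a + x * M           ≡⟨ shuffle a ⟩
    (a + x) + m * x     ≈⟨ +-congʳ (m * x) a+x≈b+x ⟩
    (b + x) + m * x     ≡⟨ shuffle b ⟨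
    b + x * M           ≈⟨ +-*M b x ⟩
    b                   ∎
    where
    open ≈-Reasoning
    shuffle : ∀ a → a + x * M ≡ (a + x) + m * x
    shuffle a = solve 3 (λ a x m → a :+ x :* (con 1 :+ m) := (a :+ x) :+ m :* x) refl a x m

  neg-unique : ∀ {a b} → a + b ≈ 0 → m * a ≈ b
  neg-unique {a} {b} a+b≈0 = +-cancelʳ a (begin
    m * a + a   ≡⟨ +-comm (m * a) a ⟩
    a + m * a   ≈⟨ +-m* a ⟩
    0           ≈⟨ a+b≈0 ⟨
    a + b       ≡⟨ +-comm a b ⟩
    b + a       ∎)
    where open ≈-Reasoning

  M≈0 : M ≈ 0
  M≈0 = ≈-trans (≡⇒≈ (sym (+-identityʳ M))) (+-*M 0 1)

  m*m≈1 : m * m ≈ 1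
  m*m≈1 = +-cancelʳ m (begin
    m * m + m  ≡⟨ solve 1 (λ m → m :* m :+ m := con 0 :+ m :* (con 1 :+ m)) refl m ⟩
    0 + m * M  ≈⟨ +-*M 0 m ⟩
    0          ≈⟨ M≈0 ⟨
    1 + m      ∎)
    where open ≈-Reasoning

  m*m≈m+2 : m * m ≈ m + 2
  m*m≈m+2 = ≈-trans m*m≈1 (≈-sym (≈-trans (≡⇒≈ (solve 1 (λ m → m :+ con 2 := con 1 :+ con 1 :* (con 1 :+ m)) refl m)) (+-*M 1 1)))

  ⟨_⟩ : Fin M → ℕ
  ⟨ i ⟩ = toℕ i

  toℕ-res : ∀ a → ⟨ res {m} a ⟩ ≈ a
  toℕ-res a = ≈-trans (≡⇒≈ (toℕ-fromℕ< (m%n<n a M))) (%M≈ a)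

  ≈⇒≡ : ∀ {a b} → a < M → b < M → a ≈ b → a ≡ b
  ≈⇒≡ a<M b<M (mk≈ p) = trans (sym (m<n⇒m%n≡m a<M)) (trans p (m<n⇒m%n≡m b<M))

  toℕ-≈-injective : ∀ {i j : Fin M} → ⟨ i ⟩ ≈ ⟨ j ⟩ → i ≡ j
  toℕ-≈-injective {i} {j} = toℕ-injective ∘ ≈⇒≡ (toℕ<n i) (toℕ<n j)

  res-cong : ∀ {a b} → a ≈ b → res {m} a ≡ res b
  res-cong {a} {b} a≈b = toℕ-≈-injective (≈-trans (toℕ-res a) (≈-trans a≈b (≈-sym (toℕ-res b))))

  res-toℕ : ∀ i → res {m} ⟨ i ⟩ ≡ i
  res-toℕ i = toℕ-≈-injective (toℕ-res ⟨ i ⟩)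

  ‖_‖ : ℕ → ℕ
  ‖ a ‖ = (a % M) ⊓ (M ∸ a % M)

  ‖‖-cong : ∀ {a b} → a ≈ b → ‖ a ‖ ≡ ‖ b ‖
  ‖‖-cong (mk≈ p) = cong (λ x → x ⊓ (M ∸ x)) p

  private
    complementary : ∀ {x y} → x < M → y < M → (x + y) % M ≡ 0 → (x ≡ 0 × y ≡ 0) ⊎ x + y ≡ M
    complementary {x} {y} x<M y<M [x+y]%M≡0 with x + y <? M
    ... | yes x+y<M = let x+y≡0 = trans (sym (m<n⇒m%n≡m x+y<M)) [x+y]%M≡0
                      in inj₁ (m+n≡0⇒m≡0 x x+y≡0 , m+n≡0⇒n≡0 x x+y≡0)
    ... | no x+y≮M = inj₂ (begin
      x + y         ≡⟨ M+d≡x+y ⟨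
      M + d         ≡⟨ cong (M +_) d≡0 ⟩
      M + 0         ≡⟨ +-identityʳ M ⟩
      M             ∎)
      where
      open ≡-Reasoning
      d = x + y ∸ M
      M+d≡x+y : M + d ≡ x + y
      M+d≡x+y = m+[n∸m]≡n (≮⇒≥ x+y≮M)
      d<M : d < M
      d<M = +-cancelˡ-< M d M (subst (_< M + M) (sym M+d≡x+y) (+-mono-< x<M y<M))
      d≡0 : d ≡ 0
      d≡0 = begin
        d             ≡⟨ m<n⇒m%n≡m d<M ⟨
        d % M         ≡⟨ [m+n]%n≡m%n d M ⟨
        (d + M) % M   ≡⟨ cong (_% M) (trans (+-comm d M) M+d≡x+y) ⟩
        (x + y) % M   ≡⟨ [x+y]%M≡0 ⟩
        0             ∎

  ‖‖-neg : ∀ {a b} → a + b ≈ 0 → ‖ a ‖ ≡ ‖ b ‖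
  ‖‖-neg {a} {b} (mk≈ [a+b]%M≡0)
    with complementary (m%n<n a M) (m%n<n b M) (trans (sym (%-distribˡ-+ a b M)) [a+b]%M≡0)
  ... | inj₁ (a≡0 , b≡0) = trans (cong (λ x → x ⊓ (M ∸ x)) a≡0) (sym (cong (λ x → x ⊓ (M ∸ x)) b≡0))
  ... | inj₂ sum≡M = begin
    (a % M) ⊓ (M ∸ a % M)  ≡⟨ cong ((a % M) ⊓_) (M∸≡ sum≡M) ⟩
    (a % M) ⊓ (b % M)      ≡⟨ ⊓-comm (a % M) (b % M) ⟩
    (b % M) ⊓ (a % M)      ≡⟨ cong ((b % M) ⊓_) (M∸≡ (trans (+-comm (b % M) (a % M)) sum≡M)) ⟨
    (b % M) ⊓ (M ∸ b % M)  ∎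
    where
    open ≡-Reasoning
    M∸≡ : ∀ {x y} → x + y ≡ M → M ∸ x ≡ y
    M∸≡ {x} {y} x+y≡M = trans (cong (_∸ x) (sym x+y≡M)) (m+n∸m≡n x y)

  double≤M⇒<M : ∀ a → a + a ≤ M → a < M
  double≤M⇒<M zero    _       = s≤s z≤n
  double≤M⇒<M (suc a) 2a+2≤M = <-≤-trans (m<m+n (suc a) (s≤s z≤n)) 2a+2≤M

  ‖‖-small : ∀ a → a + a ≤ M → ‖ a ‖ ≡ a
  ‖‖-small a a+a≤M = begin
    (a % M) ⊓ (M ∸ a % M)  ≡⟨ cong (λ x → x ⊓ (M ∸ x)) (m<n⇒m%n≡m a<M) ⟩
    a ⊓ (M ∸ a)            ≡⟨ m≤n⇒m⊓n≡m (subst (_≤ M ∸ a) (m+n∸m≡n a a) (∸-monoˡ-≤ a a+a≤M)) ⟩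
    a                      ∎
    where
    open ≡-Reasoning
    a<M = double≤M⇒<M a a+a≤M

+≈0⇒≈-mod2 : ∀ {a b} → Modular._≈_ 1 (a + b) 0 → Modular._≈_ 1 a b
+≈0⇒≈-mod2 {a} a+b≈0 = Modular.≈-trans 1 (Modular.≡⇒≈ 1 (sym (+-identityʳ a))) (Modular.neg-unique 1 a+b≈0)

reduce-modulus : ∀ {d m} → suc d ∣ suc m → ∀ {a b} → Modular._≈_ m a b → Modular._≈_ d a b
reduce-modulus {d} {m} d∣m {a} {b} (Modular.mk≈ a≡b) = Modular.mk≈ (begin
  a % suc d            ≡⟨ m∣n⇒o%n%m≡o%m (suc d) (suc m) a d∣m ⟨
  a % suc m % suc d    ≡⟨ cong (_% suc d) a≡b ⟩
  b % suc m % suc d    ≡⟨ m∣n⇒o%n%m≡o%m (suc d) (suc m) b d∣m ⟩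
  b % suc d            ∎)
  where open ≡-Reasoning

%2-cases : ∀ a → a % 2 ≡ 0 ⊎ a % 2 ≡ 1
%2-cases a with a % 2 | m%n<n a 2
... | zero        | _            = inj₁ refl
... | suc zero    | _            = inj₂ refl
... | suc (suc _) | s≤s (s≤s ())

-- Metacyclic groups

-- ⟨x, y | x^M, y² = x^c, y x y⁻¹ = x^r⟩ of order 2M; the word (a , s) stands for x^a y^s,
-- and ι reduces its exponent modulo M.
module Metacyclic (m r c : ℕ) (r²≈1 : Modular._≈_ m (r * r) 1) (rc≈c : Modular._≈_ m (r * c) c) where

  open Modular m

  Word : Set
  Word = ℕ × Bool

  infixl 7 _⋆_
  _⋆_ : Word → Word → Word
  (a , false) ⋆ (b , t)     = (a + b , t)
  (a , true)  ⋆ (b , false) = (a + r * b , true)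
  (a , true)  ⋆ (b , true)  = (a + r * b + c , false)

  inverse : Word → Word
  inverse (a , false) = (m * a , false)
  inverse (a , true)  = (m * (r * a + c) , true)

  Element : Set
  Element = Fin M × Bool

  ι : Word → Element
  ι (a , s) = (res a , s)

  ⟦_⟧ : Element → Word
  ⟦ i , s ⟧ = (⟨ i ⟩ , s)

  infixl 7 _∙_
  _∙_ : Element → Element → Element
  x ∙ y = ι (⟦ x ⟧ ⋆ ⟦ y ⟧)

  _⁻¹ : Element → Element
  x ⁻¹ = ι (inverse ⟦ x ⟧)

  group : GroupData
  group = record { Carrier = Element ; _·_ = _∙_ ; e = (zero , false) }

  ι-⟦⟧ : ∀ x → ι ⟦ x ⟧ ≡ x
  ι-⟦⟧ (i , s) = cong (_, s) (res-toℕ i)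

  ι-cong : ∀ {a b} s → a ≈ b → ι (a , s) ≡ ι (b , s)
  ι-cong s a≈b = cong (_, s) (res-cong a≈b)

  ⋆-cong : ∀ {a a′ b b′} s t → a ≈ a′ → b ≈ b′ → ι ((a , s) ⋆ (b , t)) ≡ ι ((a′ , s) ⋆ (b′ , t))
  ⋆-cong false t     a≈a′ b≈b′ = ι-cong t (+-cong a≈a′ b≈b′)
  ⋆-cong true  false a≈a′ b≈b′ = ι-cong true (+-cong a≈a′ (*-congˡ r b≈b′))
  ⋆-cong true  true  a≈a′ b≈b′ = ι-cong false (+-congʳ c (+-cong a≈a′ (*-congˡ r b≈b′)))

  ι-⋆ : ∀ u v → ι u ∙ ι v ≡ ι (u ⋆ v)
  ι-⋆ (a , s) (b , t) = ⋆-cong s t (toℕ-res a) (toℕ-res b)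

  ι-inverse : ∀ u → ι u ⁻¹ ≡ ι (inverse u)
  ι-inverse (a , false) = ι-cong false (*-congˡ m (toℕ-res a))
  ι-inverse (a , true)  = ι-cong true (*-congˡ m (+-congʳ c (*-congˡ r (toℕ-res a))))

  private
    ε : Element
    ε = (zero , false)

    r²-cancel : ∀ d → d ≈ r * (r * d)
    r²-cancel d = begin
      d            ≡⟨ solve 1 (λ d → d := con 1 :* d) refl d ⟩
      1 * d        ≈⟨ *-cong (≈-sym r²≈1) ≈-refl ⟩
      r * r * d    ≡⟨ solve 2 (λ r d → r :* r :* d := r :* (r :* d)) refl r d ⟩
      r * (r * d)  ∎
      where open ≈-Reasoning

  ⋆-assoc : ∀ u v w → ι (u ⋆ v ⋆ w) ≡ ι (u ⋆ (v ⋆ w))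
  ⋆-assoc (a , false) (b , false) (d , t)     = ι-cong t (≡⇒≈ (solve 3 (λ a b d → a :+ b :+ d := a :+ (b :+ d)) refl a b d))
  ⋆-assoc (a , false) (b , true)  (d , false) = ι-cong true (≡⇒≈ (solve 4 (λ a b d r → a :+ b :+ r :* d := a :+ (b :+ r :* d)) refl a b d r))
  ⋆-assoc (a , false) (b , true)  (d , true)  =
    ι-cong false (≡⇒≈ (solve 5 (λ a b d r c → a :+ b :+ r :* d :+ c := a :+ (b :+ r :* d :+ c)) refl a b d r c))
  ⋆-assoc (a , true)  (b , false) (d , false) =
    ι-cong true (≡⇒≈ (solve 4 (λ a b d r → a :+ r :* b :+ r :* d := a :+ r :* (b :+ d)) refl a b d r))
  ⋆-assoc (a , true)  (b , false) (d , true)  =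
    ι-cong false (≡⇒≈ (solve 5 (λ a b d r c → a :+ r :* b :+ r :* d :+ c := a :+ r :* (b :+ d) :+ c) refl a b d r c))
  ⋆-assoc (a , true)  (b , true)  (d , false) = ι-cong false (begin
    a + r * b + c + d
      ≈⟨ +-congˡ (a + r * b + c) (r²-cancel d) ⟩
    a + r * b + c + r * (r * d)
      ≡⟨ solve 5 (λ a b c d r → a :+ r :* b :+ c :+ r :* (r :* d) := a :+ r :* (b :+ r :* d) :+ c) refl a b c d r ⟩
    a + r * (b + r * d) + c ∎)
    where open ≈-Reasoning
  ⋆-assoc (a , true)  (b , true)  (d , true)  = ι-cong true (begin
    a + r * b + c + d              ≈⟨ +-cong (+-congˡ (a + r * b) (≈-sym rc≈c)) (r²-cancel d) ⟩
    a + r * b + r * c + r * (r * d) ≡⟨ solve 5 (λ a b c d r → a :+ r :* b :+ r :* c :+ r :* (r :* d) := a :+ r :* (b :+ r :* d :+ c)) refl a b c d r ⟩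
    a + r * (b + r * d + c)        ∎)
    where open ≈-Reasoning

  ⋆-identityʳ : ∀ u → ι (u ⋆ (0 , false)) ≡ ι u
  ⋆-identityʳ (a , false) = ι-cong false (≡⇒≈ (+-identityʳ a))
  ⋆-identityʳ (a , true)  = ι-cong true (≡⇒≈ (trans (cong (a +_) (*-zeroʳ r)) (+-identityʳ a)))

  ⋆-inverseʳ : ∀ u → ι (u ⋆ inverse u) ≡ ε
  ⋆-inverseʳ (a , false) = ι-cong false (+-m* a)
  ⋆-inverseʳ (a , true)  = ι-cong false (begin
    a + r * (m * (r * a + c)) + c          ≡⟨ solve 4 (λ a c m r → a :+ r :* (m :* (r :* a :+ c)) :+ c := (a :+ m :* (r :* (r :* a))) :+ (c :+ m :* (r :* c))) refl a c m r ⟩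
    (a + m * (r * (r * a))) + (c + m * (r * c)) ≈⟨ +-cong (+-congˡ a (*-congˡ m (≈-sym (r²-cancel a)))) (+-congˡ c (*-congˡ m rc≈c)) ⟩
    (a + m * a) + (c + m * c)              ≈⟨ +-cong (+-m* a) (+-m* c) ⟩
    0                                      ∎)
    where open ≈-Reasoning

  ⋆-inverseˡ : ∀ u → ι (inverse u ⋆ u) ≡ ε
  ⋆-inverseˡ (a , false) = ι-cong false (≈-trans (≡⇒≈ (solve 2 (λ a m → m :* a :+ a := a :+ m :* a) refl a m)) (+-m* a))
  ⋆-inverseˡ (a , true)  = ι-cong false (begin
    m * (r * a + c) + r * a + c
      ≡⟨ solve 4 (λ a c m r → m :* (r :* a :+ c) :+ r :* a :+ c := (r :* a :+ c) :+ m :* (r :* a :+ c)) refl a c m r ⟩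
    (r * a + c) + m * (r * a + c)
      ≈⟨ +-m* (r * a + c) ⟩
    0 ∎)
    where open ≈-Reasoning

  isGroup : IsGroup _≡_ _∙_ ε _⁻¹
  isGroup = record
    { isMonoid = record
      { isSemigroup = record
        { isMagma = record { isEquivalence = isEquivalence ; ∙-cong = cong₂ _∙_ }
        ; assoc   = assoc
        }
      ; identity = ι-⟦⟧ , λ x → trans (⋆-identityʳ ⟦ x ⟧) (ι-⟦⟧ x)
      }
    ; inverse = inverseˡ , inverseʳ
    ; ⁻¹-cong = cong _⁻¹
    }
    where
    open ≡-Reasoning
    assoc : ∀ x y z → x ∙ y ∙ z ≡ x ∙ (y ∙ z)
    assoc x y z = begin
      ι (⟦ x ⟧ ⋆ ⟦ y ⟧) ∙ z              ≡⟨ cong (ι (⟦ x ⟧ ⋆ ⟦ y ⟧) ∙_) (ι-⟦⟧ z) ⟨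
      ι (⟦ x ⟧ ⋆ ⟦ y ⟧) ∙ ι ⟦ z ⟧        ≡⟨ ι-⋆ (⟦ x ⟧ ⋆ ⟦ y ⟧) ⟦ z ⟧ ⟩
      ι (⟦ x ⟧ ⋆ ⟦ y ⟧ ⋆ ⟦ z ⟧)          ≡⟨ ⋆-assoc ⟦ x ⟧ ⟦ y ⟧ ⟦ z ⟧ ⟩
      ι (⟦ x ⟧ ⋆ (⟦ y ⟧ ⋆ ⟦ z ⟧))        ≡⟨ ι-⋆ ⟦ x ⟧ (⟦ y ⟧ ⋆ ⟦ z ⟧) ⟨
      ι ⟦ x ⟧ ∙ ι (⟦ y ⟧ ⋆ ⟦ z ⟧)        ≡⟨ cong (_∙ ι (⟦ y ⟧ ⋆ ⟦ z ⟧)) (ι-⟦⟧ x) ⟩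
      x ∙ (y ∙ z)                         ∎
    inverseʳ : ∀ x → x ∙ x ⁻¹ ≡ ε
    inverseʳ x = begin
      x ∙ x ⁻¹                           ≡⟨ cong (_∙ x ⁻¹) (ι-⟦⟧ x) ⟨
      ι ⟦ x ⟧ ∙ ι (inverse ⟦ x ⟧)        ≡⟨ ι-⋆ ⟦ x ⟧ (inverse ⟦ x ⟧) ⟩
      ι (⟦ x ⟧ ⋆ inverse ⟦ x ⟧)          ≡⟨ ⋆-inverseʳ ⟦ x ⟧ ⟩
      ε                                  ∎
    inverseˡ : ∀ x → x ⁻¹ ∙ x ≡ ε
    inverseˡ x = begin
      x ⁻¹ ∙ x                           ≡⟨ cong (x ⁻¹ ∙_) (ι-⟦⟧ x) ⟨
      ι (inverse ⟦ x ⟧) ∙ ι ⟦ x ⟧        ≡⟨ ι-⋆ (inverse ⟦ x ⟧) ⟦ x ⟧ ⟩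
      ι (inverse ⟦ x ⟧ ⋆ ⟦ x ⟧)          ≡⟨ ⋆-inverseˡ ⟦ x ⟧ ⟩
      ε                                  ∎

  open BiInvariantMetrics group _⁻¹ isGroup (≡-dec Fin._≟_ Bool._≟_) public

  twisted-∙ : c ≡ 0 → ∀ x y → x ∙ y ≡ _·_ (Twisted M r) x y
  twisted-∙ c≡0 (i , false) (j , l)     = refl
  twisted-∙ c≡0 (i , true)  (j , false) = ι-cong true (+-congˡ ⟨ i ⟩ (≈-sym (toℕ-res (r * ⟨ j ⟩))))
  twisted-∙ c≡0 (i , true)  (j , true)  = ι-cong false (begin
    ⟨ i ⟩ + r * ⟨ j ⟩ + c            ≡⟨ trans (cong (⟨ i ⟩ + r * ⟨ j ⟩ +_) c≡0) (+-identityʳ _) ⟩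
    ⟨ i ⟩ + r * ⟨ j ⟩                ≈⟨ +-congˡ ⟨ i ⟩ (toℕ-res (r * ⟨ j ⟩)) ⟨
    ⟨ i ⟩ + ⟨ res (r * ⟨ j ⟩) ⟩      ∎)
    where open ≈-Reasoning

  ι-conj : ∀ u v → ι u ∙ ι v ∙ ι u ⁻¹ ≡ ι (u ⋆ v ⋆ inverse u)
  ι-conj u v = trans (cong₂ _∙_ (ι-⋆ u v) (ι-inverse u)) (ι-⋆ (u ⋆ v) (inverse u))

  -- the exponent of h z h⁻¹ for z = x^y (rot) or x^y y (ref) and h = x^p (by-rot) or x^p y (by-ref)
  module Conjugation (p y : ℕ) where
    open ≈-Reasoning

    rot-by-rot : p + y + m * p ≈ y
    rot-by-rot = begin
      p + y + m * p    ≡⟨ solve 3 (λ p y m → p :+ y :+ m :* p := y :+ (p :+ m :* p)) refl p y m ⟩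
      y + (p + m * p)  ≈⟨ +-congˡ y (+-m* p) ⟩
      y + 0            ≡⟨ +-identityʳ y ⟩
      y                ∎

    rot-by-ref : p + r * y + r * (m * (r * p + c)) + c ≈ r * y
    rot-by-ref = begin
      p + r * y + r * (m * (r * p + c)) + c
        ≡⟨ solve 5 (λ p y m r c → p :+ r :* y :+ r :* (m :* (r :* p :+ c)) :+ c
                                  := r :* y :+ ((p :+ m :* (r :* (r :* p))) :+ (c :+ m :* (r :* c)))) refl p y m r c ⟩
      r * y + ((p + m * (r * (r * p))) + (c + m * (r * c)))
        ≈⟨ +-congˡ (r * y) (+-cong (+-congˡ p (*-congˡ m (≈-sym (r²-cancel p)))) (+-congˡ c (*-congˡ m rc≈c))) ⟩
      r * y + ((p + m * p) + (c + m * c))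
        ≈⟨ +-congˡ (r * y) (+-cong (+-m* p) (+-m* c)) ⟩
      r * y + 0
        ≡⟨ +-identityʳ (r * y) ⟩
      r * y ∎

    ref-by-rot : p + y + r * (m * p) + r * p ≈ y + p
    ref-by-rot = begin
      p + y + r * (m * p) + r * p
        ≡⟨ solve 4 (λ p y m r → p :+ y :+ r :* (m :* p) :+ r :* p := y :+ p :+ r :* (p :+ m :* p)) refl p y m r ⟩
      y + p + r * (p + m * p)
        ≈⟨ +-congˡ (y + p) (*-congˡ r (+-m* p)) ⟩
      y + p + r * 0
        ≡⟨ trans (cong (y + p +_) (*-zeroʳ r)) (+-identityʳ (y + p)) ⟩
      y + p ∎

    ref-by-ref : p + r * y + c + m * (r * p + c) + r * p ≈ r * y + p
    ref-by-ref = begin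
      p + r * y + c + m * (r * p + c) + r * p
        ≡⟨ solve 5 (λ p y m r c → p :+ r :* y :+ c :+ m :* (r :* p :+ c) :+ r :* p
                                  := r :* y :+ p :+ ((r :* p :+ c) :+ m :* (r :* p :+ c))) refl p y m r c ⟩
      r * y + p + ((r * p + c) + m * (r * p + c))  ≈⟨ +-congˡ (r * y + p) (+-m* (r * p + c)) ⟩
      r * y + p + 0                                ≡⟨ +-identityʳ (r * y + p) ⟩
      r * y + p                                    ∎

  -- x^a and x^a y, named after the dihedral case
  rot ref : ℕ → Element
  rot a = ι (a , false)
  ref a = ι (a , true)

  ∼-≈ : ∀ s {a b} → a ≈ b → ι (a , s) ∼ ι (b , s)
  ∼-≈ s {a} a≈b = subst (ι (a , s) ∼_) (ι-cong s a≈b) ∼-refl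

  private

    ∼-conjι : ∀ u v → ι v ∼ ι (u ⋆ v ⋆ inverse u)
    ∼-conjι u v = subst (ι v ∼_) (ι-conj u v) (∼-conj (ι u) (ι v))

    ∼-inverseι : ∀ v → ι v ∼ ι (inverse v)
    ∼-inverseι v = subst (ι v ∼_) (ι-inverse v) (∼-inv (ι v))

  rot-twist : ∀ {a b} → b ≈ r * a → rot a ∼ rot b
  rot-twist {a} b≈ra = ∼-trans (∼-conjι (0 , true) (a , false)) (∼-≈ false (≈-trans (Conjugation.rot-by-ref 0 a) (≈-sym b≈ra)))

  rot-inverse : ∀ {a b} → a + b ≈ 0 → rot a ∼ rot b
  rot-inverse {a} a+b≈0 = ∼-trans (∼-inverseι (a , false)) (∼-≈ false (neg-unique a+b≈0))

  ref-shift : ∀ {p a b} → b + r * p ≈ a + p → ref a ∼ ref b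
  ref-shift {p} {a} b+rp≈a+p =
    ∼-trans (∼-conjι (p , false) (a , true)) (∼-≈ true (+-cancelʳ (r * p) (≈-trans (Conjugation.ref-by-rot p a) (≈-sym b+rp≈a+p))))

  ref-inverse : ∀ {a b} → b + (r * a + c) ≈ 0 → ref a ∼ ref b
  ref-inverse {a} {b} b+ra+c≈0 =
    ∼-trans (∼-inverseι (a , true)) (∼-≈ true (neg-unique (≈-trans (≡⇒≈ (solve 2 (λ x b → x :+ b := b :+ x) refl (r * a + c) b)) b+ra+c≈0)))

  record RotationClasses (A : ℕ) : Set₁ where
    field
      {Label}       : Set
      label         : ℕ → Label
      label-twist   : ∀ {a b} → b ≈ r * a → label b ≡ label a
      label-inverse : ∀ {a b} → a + b ≈ 0 → label a ≡ label b
      rep           : Fin A → ℕ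
      rep≉0         : ∀ i → ¬ (rep i ≈ 0)
      label-rep-injective : ∀ i j → label (rep i) ≡ label (rep j) → i ≡ j
      classify      : ∀ a → ¬ (a ≈ 0) → ∃ λ i → rot a ∼ rot (rep i)

    label-≈ : ∀ {a b} → a ≈ b → label a ≡ label b
    label-≈ {a} {b} a≈b = trans (label-inverse (+-m* a)) (sym (label-inverse (≈-trans (+-congʳ (m * a) (≈-sym a≈b)) (+-m* a))))

  record ReflectionClasses (B : ℕ) : Set₁ where
    field
      {Label}       : Set
      label         : ℕ → Label
      label-twist   : ∀ {a b} → b ≈ r * a → label b ≡ label a
      label-shift   : ∀ {p a b} → b + r * p ≈ a + p → label b ≡ label a
      label-inverse : ∀ {a b} → b + (r * a + c) ≈ 0 → label b ≡ label a
      rep           : Fin B → ℕ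
      label-rep-injective : ∀ i j → label (rep i) ≡ label (rep j) → i ≡ j
      classify      : ∀ a → ∃ λ i → ref a ∼ ref (rep i)

    label-≈ : ∀ {a b} → a ≈ b → label a ≡ label b
    label-≈ {a} {b} a≈b = label-shift {0} (≈-trans (≡⇒≈ (cong (a +_) (*-zeroʳ r))) (+-congʳ 0 a≈b))

  module _ {A B} (R : RotationClasses A) (S : ReflectionClasses B) where
    private
      module R = RotationClasses R
      module S = ReflectionClasses S

      label± : Word → R.Label ⊎ S.Label
      label± (a , false) = inj₁ (R.label a)
      label± (a , true)  = inj₂ (S.label a)

      label±-ι : ∀ u → label± ⟦ ι u ⟧ ≡ label± u
      label±-ι (a , false) = cong inj₁ (R.label-≈ (toℕ-res a))
      label±-ι (a , true)  = cong inj₂ (S.label-≈ (toℕ-res a))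

      label±-conj : ∀ u v → label± (u ⋆ v ⋆ inverse u) ≡ label± v
      label±-conj (p , false) (y , false) = cong inj₁ (R.label-≈ (Conjugation.rot-by-rot p y))
      label±-conj (p , true)  (y , false) = cong inj₁ (trans (R.label-≈ (Conjugation.rot-by-ref p y)) (R.label-twist ≈-refl))
      label±-conj (p , false) (y , true)  = cong inj₂ (S.label-shift (Conjugation.ref-by-rot p y))
      label±-conj (p , true)  (y , true)  = cong inj₂ (trans (S.label-shift (Conjugation.ref-by-ref p y)) (S.label-twist ≈-refl))

      label±-inverse : ∀ v → label± (inverse v) ≡ label± v
      label±-inverse (y , false) = cong inj₁ (sym (R.label-inverse (+-m* y)))
      label±-inverse (y , true)  = cong inj₂ (S.label-inverse
        (≈-trans (≡⇒≈ (solve 2 (λ x m → m :* x :+ x := x :+ m :* x) refl (r * y + c) m)) (+-m* (r * y + c))))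

      class : Element → R.Label ⊎ S.Label
      class x = label± ⟦ x ⟧

      class-conj : ∀ h z → class (h ∙ z ∙ h ⁻¹) ≡ class z
      class-conj h z = begin
        class (h ∙ z ∙ h ⁻¹)                            ≡⟨ cong₂ (λ x y → class (x ∙ y ∙ x ⁻¹)) (ι-⟦⟧ h) (ι-⟦⟧ z) ⟨
        class (ι ⟦ h ⟧ ∙ ι ⟦ z ⟧ ∙ ι ⟦ h ⟧ ⁻¹)          ≡⟨ cong class (ι-conj ⟦ h ⟧ ⟦ z ⟧) ⟩
        class (ι (⟦ h ⟧ ⋆ ⟦ z ⟧ ⋆ inverse ⟦ h ⟧))       ≡⟨ label±-ι (⟦ h ⟧ ⋆ ⟦ z ⟧ ⋆ inverse ⟦ h ⟧) ⟩
        label± (⟦ h ⟧ ⋆ ⟦ z ⟧ ⋆ inverse ⟦ h ⟧)          ≡⟨ label±-conj ⟦ h ⟧ ⟦ z ⟧ ⟩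
        class z                                         ∎
        where open ≡-Reasoning

      class-inv : ∀ z → class (z ⁻¹) ≡ class z
      class-inv z = trans (label±-ι (inverse ⟦ z ⟧)) (label±-inverse ⟦ z ⟧)

      rep′ : Fin A ⊎ Fin B → Element
      rep′ (inj₁ i) = rot (R.rep i)
      rep′ (inj₂ j) = ref (S.rep j)

      rep : Fin (A + B) → Element
      rep = rep′ ∘ splitAt A

      rep-join : ∀ u → rep (join A B u) ≡ rep′ u
      rep-join u = cong rep′ (splitAt-join A B u)

      rep≢ε : ∀ i → rep i ≢ ε
      rep≢ε i with splitAt A i
      ... | inj₁ j = λ eq → R.rep≉0 j (≈-trans (≈-sym (toℕ-res (R.rep j))) (≡⇒≈ (cong (toℕ ∘ proj₁) eq)))
      ... | inj₂ j = λ ()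

      classify : ∀ g → g ≢ ε → ∃ λ i → g ∼ rep i
      classify (y , false) g≢ε =
        let (j , y∼j) = R.classify ⟨ y ⟩ (λ y≈0 → g≢ε (cong (_, false) (toℕ-≈-injective y≈0)))
        in join A B (inj₁ j) , subst₂ _∼_ (ι-⟦⟧ (y , false)) (sym (rep-join (inj₁ j))) y∼j
      classify (y , true) _ =
        let (j , y∼j) = S.classify ⟨ y ⟩
        in join A B (inj₂ j) , subst₂ _∼_ (ι-⟦⟧ (y , true)) (sym (rep-join (inj₂ j))) y∼j

      class-rot : ∀ a → class (rot a) ≡ inj₁ (R.label a)
      class-rot a = label±-ι (a , false)

      class-ref : ∀ a → class (ref a) ≡ inj₂ (S.label a)
      class-ref a = label±-ι (a , true)

      rep′-separated : ∀ u v → class (rep′ u) ≡ class (rep′ v) → u ≡ v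
      rep′-separated (inj₁ i) (inj₁ j) eq =
        cong inj₁ (R.label-rep-injective i j (inj₁-injective (trans (sym (class-rot (R.rep i))) (trans eq (class-rot (R.rep j))))))
      rep′-separated (inj₂ i) (inj₂ j) eq =
        cong inj₂ (S.label-rep-injective i j (inj₂-injective (trans (sym (class-ref (S.rep i))) (trans eq (class-ref (S.rep j))))))
      rep′-separated (inj₁ i) (inj₂ j) eq with () ← trans (sym (class-rot (R.rep i))) (trans eq (class-ref (S.rep j)))
      rep′-separated (inj₂ i) (inj₁ j) eq with () ← trans (sym (class-ref (S.rep i))) (trans eq (class-rot (R.rep j)))

      rep-separated : ∀ i j → rep i ∼ rep j → i ≡ j
      rep-separated i j i∼j = splitAt-injective A (rep′-separated _ _ (∼-invariant class class-conj class-inv i∼j))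

    classes⇒MStar≡Bell : MStar≡ group (Bell (A + B))
    classes⇒MStar≡Bell = transversal⇒MStar≡Bell record
      { rep = rep ; rep≢ε = rep≢ε ; classify = classify ; rep-separated = rep-separated }

  rot-complement : ∀ a b → a + b ≡ M → rot a ∼ rot b
  rot-complement a b a+b≡M = rot-inverse {a} {b} (≈-trans (≡⇒≈ a+b≡M) M≈0)

  negationRotations : r ≈ m → ∀ K → K + K ≤ M → M ≤ suc (K + K) → RotationClasses K
  negationRotations r≈m K 2K≤M M≤2K+1 = record
    { label               = ‖_‖
    ; label-twist         = λ {a} {b} b≈ra → ‖‖-neg {b} {a} (twist-neg b≈ra)
    ; label-inverse       = λ {a} {b} → ‖‖-neg {a} {b}
    ; rep                 = rep
    ; rep≉0               = rep≉0
    ; label-rep-injective = λ i j eq → toℕ-injective (suc-injective (trans (sym (‖rep‖ i)) (trans eq (‖rep‖ j))))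
    ; classify            = classify
    }
    where
    twist-neg : ∀ {a b} → b ≈ r * a → b + a ≈ 0
    twist-neg {a} {b} b≈ra = begin
      b + a        ≈⟨ +-congʳ a (≈-trans b≈ra (*-cong r≈m ≈-refl)) ⟩
      m * a + a    ≡⟨ +-comm (m * a) a ⟩
      a + m * a    ≈⟨ +-m* a ⟩
      0            ∎
      where open ≈-Reasoning

    rep : Fin K → ℕ
    rep i = suc (toℕ i)

    rep+rep≤M : ∀ i → rep i + rep i ≤ M
    rep+rep≤M i = ≤-trans (+-mono-≤ (toℕ<n i) (toℕ<n i)) 2K≤M

    ‖rep‖ : ∀ i → ‖ rep i ‖ ≡ rep i
    ‖rep‖ i = ‖‖-small (rep i) (rep+rep≤M i)

    rep≉0 : ∀ i → ¬ (rep i ≈ 0)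
    rep≉0 i = 1+n≢0 ∘ ≈⇒≡ (double≤M⇒<M _ (rep+rep≤M i)) (s≤s z≤n)

    rot-rep : ∀ {a} y (y<K : y < K) → a ≈ suc y → rot a ∼ rot (rep (fromℕ< y<K))
    rot-rep y y<K a≈1+y = ∼-≈ false (≈-trans a≈1+y (≡⇒≈ (cong suc (sym (toℕ-fromℕ< y<K)))))

    classify : ∀ a → ¬ (a ≈ 0) → ∃ λ i → rot a ∼ rot (rep i)
    classify a a≉0 = residue (a % M) (m%n<n a M) (≈-sym (%M≈ a))
      where
      residue : ∀ Y → Y < M → a ≈ Y → ∃ λ i → rot a ∼ rot (rep i)
      residue zero    _     a≈0 = ⊥-elim (a≉0 a≈0)
      residue (suc y) 1+y<M a≈1+y with y <? K
      ... | yes y<K = fromℕ< y<K , rot-rep y y<K a≈1+y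
      ... | no y≮K  =
        let (z , 1+y+z≡m) = m≤n⇒∃[o]m+o≡n (≤-pred 1+y<M)
            z<K : z < K
            z<K = +-cancelˡ-< K z K (≤-trans (s≤s (+-monoˡ-≤ z (≮⇒≥ y≮K))) (≤-trans (≤-reflexive 1+y+z≡m) (≤-pred M≤2K+1)))
        in fromℕ< z<K , ∼-trans (∼-≈ false a≈1+y)
                                (∼-trans (rot-complement (suc y) (suc z) (trans (+-suc (suc y) z) (cong suc 1+y+z≡m))) (rot-rep z z<K ≈-refl))

  -- (1 - r) u ≡ -2, so the shift by p = u (a / 2) subtracts 2 (a / 2) from the exponent
  ref-parity : ∀ u → r * u ≈ u + 2 → ∀ a → ref a ∼ ref (a % 2)
  ref-parity u ru≈u+2 a = ref-shift {u * h} (begin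
    a % 2 + r * (u * h)
      ≡⟨ cong (a % 2 +_) (*-assoc r u h) ⟨
    a % 2 + r * u * h
      ≈⟨ +-congˡ (a % 2) (*-cong ru≈u+2 ≈-refl) ⟩
    a % 2 + (u + 2) * h
      ≡⟨ solve 3 (λ x u h → x :+ (u :+ con 2) :* h := (x :+ h :* con 2) :+ u :* h) refl (a % 2) u h ⟩
    a % 2 + h * 2 + u * h
      ≡⟨ cong (_+ u * h) (m≡m%n+[m/n]*n a 2) ⟨
    a + u * h ∎)
    where
    open ≈-Reasoning
    h = a / 2

  module _ (2∣M : 2 ∣ M) (r-odd : Modular._≈_ 1 r 1) (c-even : Modular._≈_ 1 c 0) where
    private
      module ₂ = Modular 1

      to₂ : ∀ {a b} → a ≈ b → a ₂.≈ b
      to₂ = reduce-modulus 2∣M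

      r*≈₂ : ∀ a → r * a ₂.≈ a
      r*≈₂ a = ₂.≈-trans (₂.*-cong r-odd ₂.≈-refl) (₂.≡⇒≈ (+-identityʳ a))

      ≈₂-shift : ∀ {p a b} → b + r * p ≈ a + p → b ₂.≈ a
      ≈₂-shift {p} {a} {b} b+rp≈a+p = ₂.+-cancelʳ p (begin
        b + p          ≈⟨ ₂.+-congˡ b (r*≈₂ p) ⟨
        b + r * p      ≈⟨ to₂ b+rp≈a+p ⟩
        a + p          ∎)
        where open ₂.≈-Reasoning

      ≈₂-inverse : ∀ {a b} → b + (r * a + c) ≈ 0 → b ₂.≈ a
      ≈₂-inverse {a} {b} b+ra+c≈0 = +≈0⇒≈-mod2 {b} {a} (begin
        b + a              ≡⟨ cong (b +_) (+-identityʳ a) ⟨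
        b + (a + 0)        ≈⟨ ₂.+-congˡ b (₂.+-cong (₂.≈-sym (r*≈₂ a)) (₂.≈-sym c-even)) ⟩
        b + (r * a + c)    ≈⟨ to₂ b+ra+c≈0 ⟩
        0                  ∎)
        where open ₂.≈-Reasoning

    parityReflections : ∀ u → r * u ≈ u + 2 → ReflectionClasses 2
    parityReflections u ru≈u+2 = record
      { label               = _% 2
      ; label-twist         = λ {a} {b} b≈ra → ₂.%-≡ (₂.≈-trans (to₂ {b} {r * a} b≈ra) (r*≈₂ a))
      ; label-shift         = λ {p} {a} {b} b+rp≈a+p → ₂.%-≡ (≈₂-shift {p} {a} {b} b+rp≈a+p)
      ; label-inverse       = λ {a} {b} b+ra+c≈0 → ₂.%-≡ (≈₂-inverse {a} {b} b+ra+c≈0)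
      ; rep                 = toℕ
      ; label-rep-injective = λ i j eq → toℕ-injective (trans (sym (m<n⇒m%n≡m (toℕ<n i))) (trans eq (m<n⇒m%n≡m (toℕ<n j))))
      ; classify            = λ a → fromℕ< (m%n<n a 2) , subst (λ x → ref a ∼ ref x) (sym (toℕ-fromℕ< (m%n<n a 2))) (ref-parity u ru≈u+2 a)
      }

  singleReflectionClass : (∀ a → ref a ∼ ref 0) → ReflectionClasses 1
  singleReflectionClass all∼0 = record
    { label               = λ _ → tt
    ; label-twist         = λ _ → refl
    ; label-shift         = λ _ → refl
    ; label-inverse       = λ _ → refl
    ; rep                 = λ _ → 0
    ; label-rep-injective = λ { zero zero _ → refl }
    ; classify            = λ a → zero , all∼0 a
    }

-- Dihedral and dicyclic groups

module DihedralOdd (k : ℕ) where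
  m : ℕ
  m = 2 * k

  open Modular m
  open Metacyclic m m 0 m*m≈1 (≡⇒≈ (*-zeroʳ m))

  -- 2 is invertible modulo 2k + 1, so the shifts by (1 - r) p = 2p reach every exponent
  reflections-conjugate : ∀ a → ref a ∼ ref 0
  reflections-conjugate a = ref-shift {k * a} (+-cancelʳ (k * a) (begin
    0 + m * (k * a) + k * a
      ≡⟨ solve 2 (λ k a → con 0 :+ con 2 :* k :* (k :* a) :+ k :* a := con 0 :+ (k :* a) :* (con 1 :+ con 2 :* k)) refl k a ⟩
    0 + (k * a) * M
      ≈⟨ +-*M 0 (k * a) ⟩
    0
      ≈⟨ +-*M 0 a ⟨
    0 + a * M
      ≡⟨ solve 2 (λ k a → con 0 :+ a :* (con 1 :+ con 2 :* k) := a :+ k :* a :+ k :* a) refl k a ⟩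
    a + k * a + k * a ∎))
    where open ≈-Reasoning

  k+k≡m : k + k ≡ m
  k+k≡m = cong (k +_) (sym (+-identityʳ k))

  MStar≡Bell : MStar≡ (Dihedral M) (Bell (k + 1))
  MStar≡Bell = MStar≡-cong (twisted-∙ refl) (classes⇒MStar≡Bell
    (negationRotations ≈-refl k (≤-trans (≤-reflexive k+k≡m) (n≤1+n m)) (≤-reflexive (cong suc (sym k+k≡m))))
    (singleReflectionClass reflections-conjugate))

module EvenOrder (n′ : ℕ) where
  n m : ℕ
  n = suc n′
  m = 1 + 2 * n′

  open Modular m

  M≡n+n : M ≡ n + n
  M≡n+n = solve 1 (λ n → con 2 :+ con 2 :* n := (con 1 :+ n) :+ (con 1 :+ n)) refl n′

  M≡2*n : M ≡ 2 * n
  M≡2*n = trans M≡n+n (cong (n +_) (sym (+-identityʳ n)))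

  2∣M : 2 ∣ M
  2∣M = divides n (trans M≡2*n (*-comm 2 n))

  m-odd : Modular._≈_ 1 m 1
  m-odd = Modular.≈-trans 1 (Modular.≡⇒≈ 1 (cong suc (*-comm 2 n′))) (Modular.+-*M 1 1 n′)

  n+n≤M : n + n ≤ M
  n+n≤M = ≤-reflexive (sym M≡n+n)

  M≤1+n+n : M ≤ suc (n + n)
  M≤1+n+n = ≤-trans (≤-reflexive M≡n+n) (n≤1+n _)

module DihedralEven (n′ : ℕ) where
  open EvenOrder n′
  open Modular m
  open Metacyclic m m 0 m*m≈1 (≡⇒≈ (*-zeroʳ m))

  MStar≡Bell : MStar≡ (Dihedral (2 * n)) (Bell (n + 2))
  MStar≡Bell = subst (λ N → MStar≡ (Dihedral N) (Bell (n + 2))) M≡2*n (MStar≡-cong (twisted-∙ refl) (classes⇒MStar≡Bell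
    (negationRotations ≈-refl n n+n≤M M≤1+n+n)
    (parityReflections 2∣M m-odd (Modular.≈-refl 1) m m*m≈m+2)))

module DicyclicGroup (n′ : ℕ) where
  open EvenOrder n′
  open Modular m

  m*n≈n : m * n ≈ n
  m*n≈n = +-cancelʳ n (begin
    m * n + n     ≡⟨ solve 2 (λ m n → m :* n :+ n := con 0 :+ n :* (con 1 :+ m)) refl m n ⟩
    0 + n * M     ≈⟨ +-*M 0 n ⟩
    0             ≈⟨ M≈0 ⟨
    M             ≡⟨ M≡n+n ⟩
    n + n         ∎)
    where open ≈-Reasoning

  open Metacyclic m m n m*m≈1 m*n≈n

  dicyclic-∙ : ∀ x y → x ∙ y ≡ _·_ (DicyclicAux M n) x y
  dicyclic-∙ (i , false) (j , l)     = refl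
  dicyclic-∙ (i , true)  (j , false) = ι-cong true (+-congˡ ⟨ i ⟩ (≈-sym (toℕ-res (m * ⟨ j ⟩))))
  dicyclic-∙ (i , true)  (j , true)  = ι-cong false (begin
    ⟨ i ⟩ + m * ⟨ j ⟩ + n                           ≈⟨ +-congʳ n (+-congˡ ⟨ i ⟩ (toℕ-res (m * ⟨ j ⟩))) ⟨
    ⟨ i ⟩ + ⟨ res (m * ⟨ j ⟩) ⟩ + n                 ≈⟨ +-cong (toℕ-res _) (toℕ-res n) ⟨
    ⟨ res (⟨ i ⟩ + ⟨ res (m * ⟨ j ⟩) ⟩) ⟩ + ⟨ res n ⟩ ∎)
    where open ≈-Reasoning

  MStar≡Bell : ∀ {B} → ReflectionClasses B → MStar≡ (Dicyclic n) (Bell (n + B))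
  MStar≡Bell {B} reflections = subst (λ N → MStar≡ (DicyclicAux N n) (Bell (n + B))) M≡2*n
    (MStar≡-cong dicyclic-∙ (classes⇒MStar≡Bell (negationRotations ≈-refl n n+n≤M M≤1+n+n) reflections))

  MStar≡Bell-even : 2 ∣ n → MStar≡ (Dicyclic n) (Bell (n + 2))
  MStar≡Bell-even (divides q n≡q*2) = MStar≡Bell (parityReflections 2∣M m-odd n-even m m*m≈m+2)
    where
    n-even : Modular._≈_ 1 n 0
    n-even = Modular.≈-trans 1 (Modular.≡⇒≈ 1 n≡q*2) (Modular.+-*M 1 0 q)

  MStar≡Bell-odd : ¬ 2 ∣ n → MStar≡ (Dicyclic n) (Bell (n + 1))
  MStar≡Bell-odd n-odd = MStar≡Bell (singleReflectionClass reflections-conjugate)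
    where
    n%2≡1 : n % 2 ≡ 1
    n%2≡1 = [ (λ n%2≡0 → ⊥-elim (n-odd (m%n≡0⇒n∣m n 2 n%2≡0))) , (λ n%2≡1 → n%2≡1) ]′ (%2-cases n)

    ref∼ref-%2 : ∀ a {k} → a % 2 ≡ k → ref a ∼ ref k
    ref∼ref-%2 a a%2≡k = subst (λ x → ref a ∼ ref x) a%2≡k (ref-parity m m*m≈m+2 a)

    -- n is odd, so inversion connects the two parity classes of reflections
    ref1∼ref0 : ref 1 ∼ ref 0
    ref1∼ref0 = ∼-trans (ref-inverse {1} {1 + n} (begin
      (1 + n) + (m * 1 + n)  ≡⟨ solve 2 (λ n m → (con 1 :+ n) :+ (m :* con 1 :+ n) := (n :+ n) :+ (con 1 :+ m)) refl n m ⟩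
      (n + n) + M            ≡⟨ cong (_+ M) M≡n+n ⟨
      M + M                  ≡⟨ solve 1 (λ M → M :+ M := con 0 :+ con 2 :* M) refl M ⟩
      0 + 2 * M              ≈⟨ +-*M 0 2 ⟩
      0                      ∎)) (ref∼ref-%2 (1 + n) (trans (%-distribˡ-+ 1 n 2) (cong (λ x → (1 + x) % 2) n%2≡1)))
      where open ≈-Reasoning

    reflections-conjugate : ∀ a → ref a ∼ ref 0
    reflections-conjugate a = [ ref∼ref-%2 a , (λ a%2≡1 → ∼-trans (ref∼ref-%2 a a%2≡1) ref1∼ref0) ]′ (%2-cases a)

-- Quasidihedral groups

parity : ∀ n → (∃ λ w → n ≡ w * 2) ⊎ (∃ λ v → n ≡ 1 + v * 2)
parity zero          = inj₁ (0 , refl)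
parity (suc zero)    = inj₂ (0 , refl)
parity (suc (suc n)) with parity n
... | inj₁ (w , n≡2w)   = inj₁ (suc w , cong (2 +_) n≡2w)
... | inj₂ (v , n≡1+2v) = inj₂ (suc v , cong (2 +_) n≡1+2v)

-- 2^(n-4) = t + 1, so that M = 2^(n-1) = 8 (t + 1) and h = M / 2
module Quasidihedral (t r : ℕ) (r²≈1 : Modular._≈_ (7 + 8 * t) (r * r) 1) where

  m h : ℕ
  m = 7 + 8 * t
  h = 4 + 4 * t

  open Modular m
  module ₕ = Modular (3 + 4 * t)
  module ₂ = Modular 1
  open Metacyclic m r 0 r²≈1 (≡⇒≈ (*-zeroʳ r))

  M≡h*2 : M ≡ h * 2
  M≡h*2 = solve 1 (λ t → con 8 :+ con 8 :* t := (con 4 :+ con 4 :* t) :* con 2) refl t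

  h≤M : h ≤ M
  h≤M = ≤-trans (m≤m+n h h) (≤-reflexive (trans (cong (h +_) (sym (+-identityʳ h))) (trans (*-comm 2 h) (sym M≡h*2))))

  toₕ : ∀ {a b} → a ≈ b → a ₕ.≈ b
  toₕ = reduce-modulus (divides 2 (trans M≡h*2 (*-comm h 2)))

  to₂ : ∀ {a b} → a ≈ b → a ₂.≈ b
  to₂ = reduce-modulus (divides h M≡h*2)

  T₂ T₁ : ℕ
  T₂ = 2 + 2 * t
  T₁ = 1 + t

  -- parity, distance to 0 modulo h, and (for even elements only) distance to 0 modulo M
  rotationLabel : ℕ → ℕ × ℕ × ℕ
  rotationLabel a = a % 2 , ₕ.‖ a ‖ , (1 ∸ a % 2) * ‖ a ‖

  module _ (r-odd    : r ₂.≈ 1)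
           (‖r*‖ₕ    : ∀ a → ₕ.‖ r * a ‖ ≡ ₕ.‖ a ‖)
           (‖r*even‖ : ∀ w → ‖ r * (w * 2) ‖ ≡ ‖ w * 2 ‖) where

    rotationLabel-twist : ∀ {a b} → b ≈ r * a → rotationLabel b ≡ rotationLabel a
    rotationLabel-twist {a} {b} b≈ra = cong₂ _,_ b%2≡a%2 (cong₂ _,_ ‖b‖ₕ≡‖a‖ₕ even-part)
      where
      b%2≡a%2 : b % 2 ≡ a % 2
      b%2≡a%2 = ₂.%-≡ (₂.≈-trans (to₂ b≈ra) (₂.≈-trans (₂.*-cong r-odd ₂.≈-refl) (₂.≡⇒≈ (+-identityʳ a))))

      ‖b‖ₕ≡‖a‖ₕ : ₕ.‖ b ‖ ≡ ₕ.‖ a ‖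
      ‖b‖ₕ≡‖a‖ₕ = trans (ₕ.‖‖-cong (toₕ b≈ra)) (‖r*‖ₕ a)

      even-part : (1 ∸ b % 2) * ‖ b ‖ ≡ (1 ∸ a % 2) * ‖ a ‖
      even-part = [ even , odd ]′ (%2-cases a)
        where
        open ≡-Reasoning
        even : a % 2 ≡ 0 → (1 ∸ b % 2) * ‖ b ‖ ≡ (1 ∸ a % 2) * ‖ a ‖
        even a%2≡0 = cong₂ (λ p d → (1 ∸ p) * d) b%2≡a%2 (begin
          ‖ b ‖                 ≡⟨ ‖‖-cong b≈ra ⟩
          ‖ r * a ‖             ≡⟨ cong (λ x → ‖ r * x ‖) a≡w*2 ⟩
          ‖ r * (a / 2 * 2) ‖   ≡⟨ ‖r*even‖ (a / 2) ⟩
          ‖ a / 2 * 2 ‖         ≡⟨ cong ‖_‖ a≡w*2 ⟨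
          ‖ a ‖                 ∎)
          where
          a≡w*2 : a ≡ a / 2 * 2
          a≡w*2 = trans (m≡m%n+[m/n]*n a 2) (cong (_+ a / 2 * 2) a%2≡0)
        odd : a % 2 ≡ 1 → (1 ∸ b % 2) * ‖ b ‖ ≡ (1 ∸ a % 2) * ‖ a ‖
        odd a%2≡1 = trans (cong (λ p → (1 ∸ p) * ‖ b ‖) (trans b%2≡a%2 a%2≡1))
                          (cong (λ p → (1 ∸ p) * ‖ a ‖) (sym a%2≡1))

    rotationLabel-inverse : ∀ {a b} → a + b ≈ 0 → rotationLabel a ≡ rotationLabel b
    rotationLabel-inverse {a} {b} a+b≈0 =
      cong₂ _,_ a%2≡b%2 (cong₂ _,_ (ₕ.‖‖-neg {a} {b} (toₕ a+b≈0)) (cong₂ (λ p d → (1 ∸ p) * d) a%2≡b%2 (‖‖-neg {a} {b} a+b≈0)))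
      where
      a%2≡b%2 : a % 2 ≡ b % 2
      a%2≡b%2 = ₂.%-≡ (+≈0⇒≈-mod2 {a} {b} (to₂ a+b≈0))

    evenRep : Fin T₂ → ℕ
    evenRep i = suc (toℕ i) * 2

    oddRep : Fin T₁ → ℕ
    oddRep i = 1 + toℕ i * 2

    rotationRep : Fin (T₂ + T₁) → ℕ
    rotationRep = [ evenRep , oddRep ]′ ∘ splitAt T₂

    rotationRep-join : ∀ u → rotationRep (join T₂ T₁ u) ≡ [ evenRep , oddRep ]′ u
    rotationRep-join u = cong [ evenRep , oddRep ]′ (splitAt-join T₂ T₁ u)

    module _ (shift-h : ∀ u → rot (h + (1 + u * 2)) ∼ rot (1 + u * 2)) where

      private
        Classified : ℕ → Set
        Classified a = ∃ λ i → rot a ∼ rot (rotationRep i)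

        even-classified : ∀ w → w < T₂ → Classified (suc w * 2)
        even-classified w w<T₂ = join T₂ T₁ (inj₁ (fromℕ< w<T₂)) ,
          subst (λ x → rot (suc w * 2) ∼ rot x)
                (sym (trans (rotationRep-join (inj₁ (fromℕ< w<T₂))) (cong (λ x → suc x * 2) (toℕ-fromℕ< w<T₂)))) ∼-refl

        odd-classified : ∀ v → v < T₁ → Classified (1 + v * 2)
        odd-classified v v<T₁ = join T₂ T₁ (inj₂ (fromℕ< v<T₁)) ,
          subst (λ x → rot (1 + v * 2) ∼ rot x)
                (sym (trans (rotationRep-join (inj₂ (fromℕ< v<T₁))) (cong (λ x → 1 + x * 2) (toℕ-fromℕ< v<T₁)))) ∼-refl

        even-class : ∀ w → suc w * 2 < M → Classified (suc w * 2)
        even-class w 2w<M with w <? T₂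
        ... | yes w<T₂ = even-classified w w<T₂
        ... | no w≮T₂ =
          let (d , T₂+d≡w) = m≤n⇒∃[o]m+o≡n (≮⇒≥ w≮T₂)
              d<1+2t : d < 1 + 2 * t
              d<1+2t = *-cancelʳ-< 2 d (1 + 2 * t) (+-cancelˡ-< (6 + 4 * t) (d * 2) ((1 + 2 * t) * 2) (begin-strict
                6 + 4 * t + d * 2
                  ≡⟨ solve 2 (λ t d → con 6 :+ con 4 :* t :+ d :* con 2 := (con 1 :+ ((con 2 :+ con 2 :* t) :+ d)) :* con 2) refl t d ⟩
                suc (T₂ + d) * 2
                  ≡⟨ cong (λ x → suc x * 2) T₂+d≡w ⟩
                suc w * 2
                  <⟨ 2w<M ⟩
                M
                  ≡⟨ solve 1 (λ t → con 8 :+ con 8 :* t := con 6 :+ con 4 :* t :+ (con 1 :+ con 2 :* t) :* con 2) refl t ⟩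
                6 + 4 * t + (1 + 2 * t) * 2 ∎))
              (d′ , d+d′≡2t) = m≤n⇒∃[o]m+o≡n (≤-pred d<1+2t)
              sum≡M : suc w * 2 + suc d′ * 2 ≡ M
              sum≡M = begin-equality
                suc w * 2 + suc d′ * 2           ≡⟨ cong (λ x → suc x * 2 + suc d′ * 2) T₂+d≡w ⟨
                suc (T₂ + d) * 2 + suc d′ * 2    ≡⟨ solve 3 (λ t d d′ → (con 1 :+ ((con 2 :+ con 2 :* t) :+ d)) :* con 2 :+ (con 1 :+ d′) :* con 2
                                                               := con 8 :+ con 4 :* t :+ (d :+ d′) :* con 2) refl t d d′ ⟩
                8 + 4 * t + (d + d′) * 2         ≡⟨ cong (λ x → 8 + 4 * t + x * 2) d+d′≡2t ⟩
                8 + 4 * t + 2 * t * 2           ≡⟨ solve 1 (λ t → con 8 :+ con 4 :* t :+ con 2 :* t :* con 2 := con 8 :+ con 8 :* t) refl t ⟩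
                M                               ∎
              (i , d′∼i) = even-classified d′ (s≤s (≤-trans (m≤n+m d′ d) (≤-trans (≤-reflexive d+d′≡2t) (n≤1+n _))))
          in i , ∼-trans (rot-complement (suc w * 2) (suc d′ * 2) sum≡M) d′∼i
          where open ≤-Reasoning

        odd-below-h : ∀ v → 1 + v * 2 < h → Classified (1 + v * 2)
        odd-below-h v 1+2v<h with v <? T₁
        ... | yes v<T₁ = odd-classified v v<T₁
        ... | no v≮T₁ =
          let (d , T₁+d≡v) = m≤n⇒∃[o]m+o≡n (≮⇒≥ v≮T₁)
              d<1+t : d < 1 + t
              d<1+t = *-cancelʳ-< 2 d (1 + t) (≤-trans (+-cancelˡ-< (3 + 2 * t) (d * 2) (1 + 2 * t) (begin-strict
                3 + 2 * t + d * 2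
                  ≡⟨ solve 2 (λ t d → con 3 :+ con 2 :* t :+ d :* con 2 := con 1 :+ ((con 1 :+ t) :+ d) :* con 2) refl t d ⟩
                1 + (T₁ + d) * 2
                  ≡⟨ cong (λ x → 1 + x * 2) T₁+d≡v ⟩
                1 + v * 2
                  <⟨ 1+2v<h ⟩
                h
                  ≡⟨ solve 1 (λ t → con 4 :+ con 4 :* t := con 3 :+ con 2 :* t :+ (con 1 :+ con 2 :* t)) refl t ⟩
                3 + 2 * t + (1 + 2 * t) ∎))
                        (≤-trans (n≤1+n _) (≤-reflexive (solve 1 (λ t → con 2 :+ con 2 :* t := (con 1 :+ t) :* con 2) refl t))))
              (u , d+u≡t) = m≤n⇒∃[o]m+o≡n (≤-pred d<1+t)
              sum≡M : 1 + v * 2 + (h + (1 + u * 2)) ≡ M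
              sum≡M = begin-equality
                1 + v * 2 + (h + (1 + u * 2))          ≡⟨ cong (λ x → 1 + x * 2 + (h + (1 + u * 2))) T₁+d≡v ⟨
                1 + (T₁ + d) * 2 + (h + (1 + u * 2))   ≡⟨ solve 3 (λ t d u → con 1 :+ ((con 1 :+ t) :+ d) :* con 2 :+ ((con 4 :+ con 4 :* t) :+ (con 1 :+ u :* con 2))
                                                                     := con 8 :+ con 6 :* t :+ (d :+ u) :* con 2) refl t d u ⟩
                8 + 6 * t + (d + u) * 2                ≡⟨ cong (λ x → 8 + 6 * t + x * 2) d+u≡t ⟩
                8 + 6 * t + t * 2                      ≡⟨ solve 1 (λ t → con 8 :+ con 6 :* t :+ t :* con 2 := con 8 :+ con 8 :* t) refl t ⟩
                M                                      ∎
              (i , u∼i) = odd-classified u (s≤s (≤-trans (m≤n+m u d) (≤-reflexive d+u≡t)))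
          in i , ∼-trans (rot-complement (1 + v * 2) (h + (1 + u * 2)) sum≡M) (∼-trans (shift-h u) u∼i)
          where open ≤-Reasoning

        odd-class : ∀ v → 1 + v * 2 < M → Classified (1 + v * 2)
        odd-class v 1+2v<M with v <? T₂
        ... | yes v<T₂ = odd-below-h v (s≤s (≤-trans (s≤s (*-monoˡ-≤ 2 (≤-pred v<T₂)))
                                          (≤-reflexive (solve 1 (λ t → con 1 :+ (con 1 :+ con 2 :* t) :* con 2 := con 3 :+ con 4 :* t) refl t))))
        ... | no v≮T₂ =
          let (d , T₂+d≡v) = m≤n⇒∃[o]m+o≡n (≮⇒≥ v≮T₂)
              1+2v≡h+1+2d : 1 + v * 2 ≡ h + (1 + d * 2)
              1+2v≡h+1+2d = trans (cong (λ x → 1 + x * 2) (sym T₂+d≡v))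
                                  (solve 2 (λ t d → con 1 :+ ((con 2 :+ con 2 :* t) :+ d) :* con 2 := (con 4 :+ con 4 :* t) :+ (con 1 :+ d :* con 2)) refl t d)
              1+2d<h : 1 + d * 2 < h
              1+2d<h = +-cancelˡ-< h (1 + d * 2) h (subst₂ _<_ 1+2v≡h+1+2d (trans M≡h*2 (solve 1 (λ h → h :* con 2 := h :+ h) refl h)) 1+2v<M)
              (i , d∼i) = odd-below-h d 1+2d<h
          in i , subst (λ x → rot x ∼ rot (rotationRep i)) (sym 1+2v≡h+1+2d) (∼-trans (shift-h d) d∼i)

        classify : ∀ a → ¬ (a ≈ 0) → Classified a
        classify a a≉0 = residue (a % M) (m%n<n a M) (≈-sym (%M≈ a))
          where
          residue : ∀ Y → Y < M → a ≈ Y → Classified a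
          residue Y Y<M a≈Y with parity Y
          ... | inj₁ (zero , Y≡0)     = ⊥-elim (a≉0 (≈-trans a≈Y (≡⇒≈ Y≡0)))
          ... | inj₁ (suc w , Y≡2+2w) =
            let (i , ∼i) = even-class w (subst (_< M) Y≡2+2w Y<M)
            in i , ∼-trans (∼-≈ false (≈-trans a≈Y (≡⇒≈ Y≡2+2w))) ∼i
          ... | inj₂ (v , Y≡1+2v)     =
            let (i , ∼i) = odd-class v (subst (_< M) Y≡1+2v Y<M)
            in i , ∼-trans (∼-≈ false (≈-trans a≈Y (≡⇒≈ Y≡1+2v))) ∼i

        evenRep-double≤M : ∀ j → evenRep j + evenRep j ≤ M
        evenRep-double≤M j = begin
          suc (toℕ j) * 2 + suc (toℕ j) * 2
            ≡⟨ solve 1 (λ x → x :* con 2 :+ x :* con 2 := x :* con 4) refl (suc (toℕ j)) ⟩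
          suc (toℕ j) * 4
            ≤⟨ *-monoˡ-≤ 4 (toℕ<n j) ⟩
          T₂ * 4
            ≡⟨ solve 1 (λ t → (con 2 :+ con 2 :* t) :* con 4 := con 8 :+ con 8 :* t) refl t ⟩
          M ∎
          where open ≤-Reasoning

        oddRep-double≤h : ∀ j → oddRep j + oddRep j ≤ h
        oddRep-double≤h j = begin
          1 + toℕ j * 2 + (1 + toℕ j * 2)
            ≡⟨ solve 1 (λ x → con 1 :+ x :* con 2 :+ (con 1 :+ x :* con 2) := con 2 :+ x :* con 4) refl (toℕ j) ⟩
          2 + toℕ j * 4
            ≤⟨ +-monoʳ-≤ 2 (*-monoˡ-≤ 4 (≤-pred (toℕ<n j))) ⟩
          2 + t * 4
            ≤⟨ ≤-trans (n≤1+n _) (n≤1+n _) ⟩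
          4 + t * 4
            ≡⟨ cong (4 +_) (*-comm t 4) ⟩
          h ∎
          where open ≤-Reasoning

        label-evenRep : ∀ j → rotationLabel (evenRep j) ≡ (0 , ₕ.‖ evenRep j ‖ , evenRep j)
        label-evenRep j = cong₂ _,_ (m*n%n≡0 (suc (toℕ j)) 2)
          (cong (ₕ.‖ evenRep j ‖ ,_) (trans (cong (λ p → (1 ∸ p) * ‖ evenRep j ‖) (m*n%n≡0 (suc (toℕ j)) 2))
                                              (trans (+-identityʳ _) (‖‖-small _ (evenRep-double≤M j)))))

        label-oddRep : ∀ j → rotationLabel (oddRep j) ≡ (1 , oddRep j , 0)
        label-oddRep j = cong₂ _,_ odd (cong₂ _,_ (ₕ.‖‖-small _ (oddRep-double≤h j)) (cong (λ p → (1 ∸ p) * ‖ oddRep j ‖) odd))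
          where
          odd : oddRep j % 2 ≡ 1
          odd = [m+kn]%n≡m%n 1 (toℕ j) 2

        rep≉0 : ∀ i → ¬ (rotationRep i ≈ 0)
        rep≉0 i with splitAt T₂ i
        ... | inj₁ j = 1+n≢0 ∘ ≈⇒≡ (double≤M⇒<M _ (evenRep-double≤M j)) (s≤s z≤n)
        ... | inj₂ j = 1+n≢0 ∘ ≈⇒≡ (double≤M⇒<M _ (≤-trans (oddRep-double≤h j) h≤M)) (s≤s z≤n)

        rep′-injective : ∀ u v → rotationLabel ([ evenRep , oddRep ]′ u) ≡ rotationLabel ([ evenRep , oddRep ]′ v) → u ≡ v
        rep′-injective (inj₁ i) (inj₁ j) eq = cong inj₁ (toℕ-injective (suc-injective (*-cancelʳ-≡ (suc (toℕ i)) (suc (toℕ j)) 2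
          (cong (proj₂ ∘ proj₂) (trans (sym (label-evenRep i)) (trans eq (label-evenRep j)))))))
        rep′-injective (inj₂ i) (inj₂ j) eq = cong inj₂ (toℕ-injective (*-cancelʳ-≡ (toℕ i) (toℕ j) 2 (suc-injective
          (cong (proj₁ ∘ proj₂) (trans (sym (label-oddRep i)) (trans eq (label-oddRep j)))))))
        rep′-injective (inj₁ i) (inj₂ j) eq = ⊥-elim (0≢1+n (cong proj₁ (trans (sym (label-evenRep i)) (trans eq (label-oddRep j)))))
        rep′-injective (inj₂ i) (inj₁ j) eq = ⊥-elim (0≢1+n (cong proj₁ (trans (sym (label-evenRep j)) (trans (sym eq) (label-oddRep i)))))

      rotationClasses : RotationClasses (T₂ + T₁)
      rotationClasses = record
        { label               = rotationLabel
        ; label-twist         = λ {a} {b} → rotationLabel-twist {a} {b}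
        ; label-inverse       = λ {a} {b} → rotationLabel-inverse {a} {b}
        ; rep                 = rotationRep
        ; rep≉0               = rep≉0
        ; label-rep-injective = λ i j eq → splitAt-injective T₂ (rep′-injective (splitAt T₂ i) (splitAt T₂ j) eq)
        ; classify            = classify
        }

module QuasidihedralMinus (t : ℕ) where
  r : ℕ
  r = 3 + 4 * t

  open Modular (7 + 8 * t)

  r²≈1 : r * r ≈ 1
  r²≈1 = begin
    r * r
      ≡⟨ solve 1 (λ t → (con 3 :+ con 4 :* t) :* (con 3 :+ con 4 :* t)
                       := con 1 :+ (con 1 :+ con 2 :* t) :* (con 8 :+ con 8 :* t)) refl t ⟩
    1 + (1 + 2 * t) * M
      ≈⟨ +-*M 1 (1 + 2 * t) ⟩
    1 ∎
    where open ≈-Reasoning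

  open Quasidihedral t r r²≈1
  open Metacyclic m r 0 r²≈1 (≡⇒≈ (*-zeroʳ r))

  r-odd : r ₂.≈ 1
  r-odd = ₂.≈-trans (₂.≡⇒≈ (solve 1 (λ t → con 3 :+ con 4 :* t := con 1 :+ (con 1 :+ con 2 :* t) :* con 2) refl t)) (₂.+-*M 1 (1 + 2 * t))

  ‖r*‖ₕ : ∀ a → ₕ.‖ r * a ‖ ≡ ₕ.‖ a ‖
  ‖r*‖ₕ a = ₕ.‖‖-neg {r * a} {a} (ₕ.≈-trans (ₕ.≡⇒≈ identity) (ₕ.+-*M 0 a))
    where
    identity : r * a + a ≡ 0 + a * h
    identity = solve 2 (λ t a → (con 3 :+ con 4 :* t) :* a :+ a := con 0 :+ a :* (con 4 :+ con 4 :* t)) refl t a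

  ‖r*even‖ : ∀ w → ‖ r * (w * 2) ‖ ≡ ‖ w * 2 ‖
  ‖r*even‖ w = ‖‖-neg {r * (w * 2)} {w * 2} (≈-trans (≡⇒≈ identity) (+-*M 0 w))
    where
    identity : r * (w * 2) + w * 2 ≡ 0 + w * M
    identity = solve 2 (λ t w → (con 3 :+ con 4 :* t) :* (w :* con 2) :+ w :* con 2 := con 0 :+ w :* (con 8 :+ con 8 :* t)) refl t w

  shift-h : ∀ u → rot (h + (1 + u * 2)) ∼ rot (1 + u * 2)
  shift-h u = ∼-trans (rot-twist {h + z} ≈-refl) (rot-inverse {r * (h + z)} {z} (≈-trans (≡⇒≈ identity) (+-*M 0 (2 + 2 * t + u))))
    where
    z = 1 + u * 2
    identity : r * (h + z) + z ≡ 0 + (2 + 2 * t + u) * M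
    identity = solve 2 (λ t u → (con 3 :+ con 4 :* t) :* ((con 4 :+ con 4 :* t) :+ (con 1 :+ u :* con 2)) :+ (con 1 :+ u :* con 2)
                              := con 0 :+ (con 2 :+ con 2 :* t :+ u) :* (con 8 :+ con 8 :* t)) refl t u

  r*u≈u+2 : r * (1 + 2 * t) ≈ 1 + 2 * t + 2
  r*u≈u+2 = begin
    r * (1 + 2 * t)
      ≡⟨ solve 1 (λ t → (con 3 :+ con 4 :* t) :* (con 1 :+ con 2 :* t)
                       := (con 1 :+ con 2 :* t :+ con 2) :+ t :* (con 8 :+ con 8 :* t)) refl t ⟩
    1 + 2 * t + 2 + t * M
      ≈⟨ +-*M (1 + 2 * t + 2) t ⟩
    1 + 2 * t + 2 ∎
    where open ≈-Reasoning

  MStar≡Bell : MStar≡ (Twisted M r) (Bell (T₂ + T₁ + 2))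
  MStar≡Bell = MStar≡-cong (twisted-∙ refl) (classes⇒MStar≡Bell
    (rotationClasses r-odd ‖r*‖ₕ ‖r*even‖ shift-h)
    (parityReflections (divides h M≡h*2) r-odd ₂.≈-refl (1 + 2 * t) r*u≈u+2))

module QuasidihedralPlus (t : ℕ) where
  r : ℕ
  r = 5 + 4 * t

  open Modular (7 + 8 * t)

  r²≈1 : r * r ≈ 1
  r²≈1 = begin
    r * r
      ≡⟨ solve 1 (λ t → (con 5 :+ con 4 :* t) :* (con 5 :+ con 4 :* t)
                       := con 1 :+ (con 3 :+ con 2 :* t) :* (con 8 :+ con 8 :* t)) refl t ⟩
    1 + (3 + 2 * t) * M
      ≈⟨ +-*M 1 (3 + 2 * t) ⟩
    1 ∎
    where open ≈-Reasoning

  open Quasidihedral t r r²≈1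
  open Metacyclic m r 0 r²≈1 (≡⇒≈ (*-zeroʳ r))

  r-odd : r ₂.≈ 1
  r-odd = ₂.≈-trans (₂.≡⇒≈ (solve 1 (λ t → con 5 :+ con 4 :* t := con 1 :+ (con 2 :+ con 2 :* t) :* con 2) refl t)) (₂.+-*M 1 (2 + 2 * t))

  r*≈ₕ : ∀ a → r * a ₕ.≈ a
  r*≈ₕ a = ₕ.≈-trans (ₕ.≡⇒≈ identity) (ₕ.+-*M a a)
    where
    identity : r * a ≡ a + a * h
    identity = solve 2 (λ t a → (con 5 :+ con 4 :* t) :* a := a :+ a :* (con 4 :+ con 4 :* t)) refl t a

  ‖r*even‖ : ∀ w → ‖ r * (w * 2) ‖ ≡ ‖ w * 2 ‖
  ‖r*even‖ w = ‖‖-cong (≈-trans (≡⇒≈ identity) (+-*M (w * 2) w))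
    where
    identity : r * (w * 2) ≡ w * 2 + w * M
    identity = solve 2 (λ t w → (con 5 :+ con 4 :* t) :* (w :* con 2) := w :* con 2 :+ w :* (con 8 :+ con 8 :* t)) refl t w

  shift-h : ∀ u → rot (h + (1 + u * 2)) ∼ rot (1 + u * 2)
  shift-h u = rot-twist {h + z} {z} (≈-sym (≈-trans (≡⇒≈ identity) (+-*M z (3 + 2 * t + u))))
    where
    z = 1 + u * 2
    identity : r * (h + z) ≡ z + (3 + 2 * t + u) * M
    identity = solve 2 (λ t u → (con 5 :+ con 4 :* t) :* ((con 4 :+ con 4 :* t) :+ (con 1 :+ u :* con 2))
                              := (con 1 :+ u :* con 2) :+ (con 3 :+ con 2 :* t :+ u) :* (con 8 :+ con 8 :* t)) refl t u

  B : ℕ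
  B = 3 + 2 * t

  ref-shift-h : ∀ w → ref (h + w) ∼ ref w
  ref-shift-h w = ref-shift {1} {h + w} {w} (≡⇒≈ (solve 2 (λ t w → w :+ (con 5 :+ con 4 :* t) :* con 1 := (con 4 :+ con 4 :* t) :+ w :+ con 1)
                                                       refl t w))

  private
    Classified : ℕ → Set
    Classified a = ∃ λ (i : Fin B) → ref a ∼ ref (toℕ i)

    direct : ∀ w → w < B → Classified w
    direct w w<B = fromℕ< w<B , subst (λ x → ref w ∼ ref x) (sym (toℕ-fromℕ< w<B)) ∼-refl

    complement<B : ∀ {w V} → B ≤ w → w + V ≡ h → V < B
    complement<B {w} {V} B≤w w+V≡h = s≤s (≤-trans (+-cancelˡ-≤ B V (1 + 2 * t) (begin
      B + V             ≤⟨ +-monoˡ-≤ V B≤w ⟩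
      w + V             ≡⟨ w+V≡h ⟩
      h                 ≡⟨ solve 1 (λ t → con 4 :+ con 4 :* t := (con 3 :+ con 2 :* t) :+ (con 1 :+ con 2 :* t)) refl t ⟩
      B + (1 + 2 * t)   ∎)) (n≤1+n _))
      where open ≤-Reasoning

    -- r w = w + h w, and h w ≡ 0 or h (mod M) according to the parity of w
    ref-reflect : ∀ w V → w + V ≡ h → ref w ∼ ref V
    ref-reflect w V w+V≡h = [ even , odd ]′ (parity w)
      where
      open ≡-Reasoning
      even : (∃ λ g → w ≡ g * 2) → ref w ∼ ref V
      even (g , w≡2g) = ∼-trans (ref-inverse {w} {h + V} (≈-trans (≡⇒≈ (begin
        h + V + (r * w + 0)    ≡⟨ solve 4 (λ t h V w → h :+ V :+ ((con 5 :+ con 4 :* t) :* w :+ con 0) := h :+ (w :+ V) :+ (con 4 :+ con 4 :* t) :* w) refl t h V w ⟩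
        h + (w + V) + h * w    ≡⟨ cong₂ (λ x y → h + x + h * y) w+V≡h w≡2g ⟩
        h + h + h * (g * 2)    ≡⟨ solve 2 (λ t g → (con 4 :+ con 4 :* t) :+ (con 4 :+ con 4 :* t) :+ (con 4 :+ con 4 :* t) :* (g :* con 2)
                                          := con 0 :+ (con 1 :+ g) :* (con 8 :+ con 8 :* t)) refl t g ⟩
        0 + (1 + g) * M        ∎)) (+-*M 0 (1 + g)))) (ref-shift-h V)
      odd : (∃ λ g → w ≡ 1 + g * 2) → ref w ∼ ref V
      odd (g , w≡1+2g) = ref-inverse {w} {V} (≈-trans (≡⇒≈ (begin
        V + (r * w + 0)        ≡⟨ solve 3 (λ t V w → V :+ ((con 5 :+ con 4 :* t) :* w :+ con 0) := (w :+ V) :+ (con 4 :+ con 4 :* t) :* w) refl t V w ⟩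
        (w + V) + h * w        ≡⟨ cong₂ (λ x y → x + h * y) w+V≡h w≡1+2g ⟩
        h + h * (1 + g * 2)    ≡⟨ solve 2 (λ t g → (con 4 :+ con 4 :* t) :+ (con 4 :+ con 4 :* t) :* (con 1 :+ g :* con 2)
                                          := con 0 :+ (con 1 :+ g) :* (con 8 :+ con 8 :* t)) refl t g ⟩
        0 + (1 + g) * M        ∎)) (+-*M 0 (1 + g)))

    below-h : ∀ w → w < h → Classified w
    below-h w w<h = [ direct w , reflected ]′ (toSum (w <? B))
      where
      reflected : ¬ w < B → Classified w
      reflected w≮B =
        let (V , w+V≡h) = m≤n⇒∃[o]m+o≡n (<⇒≤ w<h)
            (i , V∼i) = direct V (complement<B (≮⇒≥ w≮B) w+V≡h)
        in i , ∼-trans (ref-reflect w V w+V≡h) V∼i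

    classify : ∀ a → Classified a
    classify a = [ below , above ]′ (toSum (Y <? h))
      where
      Y = a % M
      a∼Y : ref a ∼ ref Y
      a∼Y = ∼-≈ true (≈-sym (%M≈ a))
      below : Y < h → Classified a
      below Y<h = let (i , Y∼i) = below-h Y Y<h in i , ∼-trans a∼Y Y∼i
      above : ¬ Y < h → Classified a
      above Y≮h =
        let (W , h+W≡Y) = m≤n⇒∃[o]m+o≡n (≮⇒≥ Y≮h)
            W<h = +-cancelˡ-< h W h (subst₂ _<_ (sym h+W≡Y) (trans M≡h*2 (trans (*-comm h 2) (cong (h +_) (+-identityʳ h)))) (m%n<n a M))
            (i , W∼i) = below-h W W<h
        in i , ∼-trans a∼Y (∼-trans (subst (λ x → ref x ∼ ref W) h+W≡Y (ref-shift-h W)) W∼i)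

    ‖toℕ‖ₕ : ∀ (i : Fin B) → ₕ.‖ toℕ i ‖ ≡ toℕ i
    ‖toℕ‖ₕ i = ₕ.‖‖-small (toℕ i) (≤-trans (+-mono-≤ (≤-pred (toℕ<n i)) (≤-pred (toℕ<n i)))
                                             (≤-reflexive (solve 1 (λ t → (con 2 :+ con 2 :* t) :+ (con 2 :+ con 2 :* t) := con 4 :+ con 4 :* t) refl t)))

  reflectionClasses : ReflectionClasses B
  reflectionClasses = record
    { label               = ₕ.‖_‖
    ; label-twist         = λ {a} {b} b≈ra → trans (ₕ.‖‖-cong (toₕ {b} {r * a} b≈ra)) (ₕ.‖‖-cong (r*≈ₕ a))
    ; label-shift         = λ {p} {a} {b} b+rp≈a+p → ₕ.‖‖-cong (shiftₕ {p} {a} {b} b+rp≈a+p)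
    ; label-inverse       = λ {a} {b} b+ra≈0 → ₕ.‖‖-neg {b} {a} (inverseₕ {a} {b} b+ra≈0)
    ; rep                 = toℕ
    ; label-rep-injective = λ i j eq → toℕ-injective (trans (sym (‖toℕ‖ₕ i)) (trans eq (‖toℕ‖ₕ j)))
    ; classify            = classify
    }
    where
    shiftₕ : ∀ {p a b} → b + r * p ≈ a + p → b ₕ.≈ a
    shiftₕ {p} {a} {b} b+rp≈a+p = ₕ.+-cancelʳ p (begin
      b + p                ≈⟨ ₕ.+-congˡ b (r*≈ₕ p) ⟨
      b + r * p            ≈⟨ toₕ b+rp≈a+p ⟩
      a + p                ∎)
      where open ₕ.≈-Reasoning

    inverseₕ : ∀ {a b} → b + (r * a + 0) ≈ 0 → b + a ₕ.≈ 0
    inverseₕ {a} {b} b+ra≈0 = begin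
      b + a                ≈⟨ ₕ.+-congˡ b (r*≈ₕ a) ⟨
      b + r * a            ≡⟨ cong (b +_) (+-identityʳ (r * a)) ⟨
      b + (r * a + 0)      ≈⟨ toₕ b+ra≈0 ⟩
      0                    ∎
      where open ₕ.≈-Reasoning

  MStar≡Bell : MStar≡ (Twisted M r) (Bell (T₂ + T₁ + B))
  MStar≡Bell = MStar≡-cong (twisted-∙ refl) (classes⇒MStar≡Bell
    (rotationClasses r-odd (λ a → ₕ.‖‖-cong (r*≈ₕ a)) ‖r*even‖ shift-h) reflectionClasses)

MStar≡-Twisted-cong : ∀ {M M′ r r′ k k′} → M ≡ M′ → r ≡ r′ → k ≡ k′ →
                      MStar≡ (Twisted M r) (Bell k) → MStar≡ (Twisted M′ r′) (Bell k′)
MStar≡-Twisted-cong refl refl refl mstar = mstar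

2^≡suc : ∀ u → ∃ λ t → suc t ≡ 2 ^ u
2^≡suc u with 2 ^ u | m^n>0 2 u
... | suc t | _ = t , refl

quasidihedral : ∀ u t → suc t ≡ 2 ^ u →
                MStar≡ (QDminus (4 + u)) (Bell (3 * 2 ^ u + 2)) × MStar≡ (QDplus (4 + u)) (Bell (5 * 2 ^ u + 1))
quasidihedral u t 1+t≡2^u =
  MStar≡-Twisted-cong M≡ (cong (_∸ 1) h≡) k⁻≡ (QuasidihedralMinus.MStar≡Bell t) ,
  MStar≡-Twisted-cong M≡ (trans (+-comm 1 (4 + 4 * t)) (cong (_+ 1) h≡)) k⁺≡ (QuasidihedralPlus.MStar≡Bell t)
  where
  h≡ : 4 + 4 * t ≡ 2 ^ (2 + u)
  h≡ = trans (solve 1 (λ t → con 4 :+ con 4 :* t := con 2 :* (con 2 :* (con 1 :+ t))) refl t) (cong (λ x → 2 * (2 * x)) 1+t≡2^u)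
  M≡ : 8 + 8 * t ≡ 2 ^ (3 + u)
  M≡ = trans (solve 1 (λ t → con 8 :+ con 8 :* t := con 2 :* (con 4 :+ con 4 :* t)) refl t) (cong (2 *_) h≡)
  k⁻≡ : (2 + 2 * t) + (1 + t) + 2 ≡ 3 * 2 ^ u + 2
  k⁻≡ = trans (solve 1 (λ t → (con 2 :+ con 2 :* t) :+ (con 1 :+ t) :+ con 2 := con 3 :* (con 1 :+ t) :+ con 2) refl t)
              (cong (λ x → 3 * x + 2) 1+t≡2^u)
  k⁺≡ : (2 + 2 * t) + (1 + t) + (3 + 2 * t) ≡ 5 * 2 ^ u + 1
  k⁺≡ = trans (solve 1 (λ t → (con 2 :+ con 2 :* t) :+ (con 1 :+ t) :+ (con 3 :+ con 2 :* t) := con 5 :* (con 1 :+ t) :+ con 1) refl t)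
              (cong (λ x → 5 * x + 1) 1+t≡2^u)

-- of the lower bounds on k and n only positivity is used
proposition6p3 :
    ((∀ k → 1 ≤ k → MStar≡ (Dihedral (2 * k + 1)) (Bell (k + 1)))
      × (∀ k → 2 ≤ k → MStar≡ (Dihedral (2 * k)) (Bell (k + 2))))
    × ((∀ n → 2 ≤ n → 2 ∣ n → MStar≡ (Dicyclic n) (Bell (n + 2)))
      × (∀ n → 3 ≤ n → ¬ 2 ∣ n → MStar≡ (Dicyclic n) (Bell (n + 1))))
    × (∀ n → 4 ≤ n →
        MStar≡ (QDminus n) (Bell (3 * 2 ^ (n ∸ 4) + 2))
        × MStar≡ (QDplus n) (Bell (5 * 2 ^ (n ∸ 4) + 1)))
proposition6p3 =
  ( (λ k _ → subst (λ n → MStar≡ (Dihedral n) (Bell (k + 1))) (+-comm 1 (2 * k)) (DihedralOdd.MStar≡Bell k))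
  , (λ { (suc n′) _ → DihedralEven.MStar≡Bell n′ }) )
  , ( (λ { (suc n′) _ → DicyclicGroup.MStar≡Bell-even n′ })
    , (λ { (suc n′) _ → DicyclicGroup.MStar≡Bell-odd n′ }) )
  , λ { (suc (suc (suc (suc u)))) (s≤s (s≤s (s≤s (s≤s _)))) → let (t , 1+t≡2^u) = 2^≡suc u in quasidihedral u t 1+t≡2^u }
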